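{- $\mathrm{D}^*$ is contained in $\mathcal{L}_{RE}$: for every $\tau$-sentence $\varphi$ of $\mathrm{D}^*$ ($\tau$ a finite relational vocabulary) there is a $\tau$-sentence $\psi$ of $\mathcal{L}_{RE}$ such that for every finite $\tau$-model $\mathfrak{A}$, $\mathfrak{A}\models\varphi$ iff $\mathfrak{A}\models\psi$.
   Context: Vocabularies are purely relational; models have nonempty domains. ESO $\tau$-sentences are $\exists X_1\cdots\exists X_k\,\psi$ with $\psi$ first-order over $\tau\cup\{X_1,\dots,X_k\}$. $\mathcal{L}_{RE}$: $\tau$-sentences $\mathrm{I}Y\,\psi$ with $Y\notin\tau$ unary and $\psi$ an ESO-sentence over $\tau\cup\{Y\}$; $\mathfrak{A}\models\mathrm{I}Y\psi$ iff for some finite nonempty $S$ with $S\cap A=\emptyset$, the $\tau\cup\{Y\}$-model with domain $A\cup S$, $Y$ interpreted as $S$ and $\tau$-relations as in $\mathfrak{A}$, satisfies $\psi$. Lax team semantics: assignments $s:X\to A$ ($X$ a finite set of variables), teams are sets of assignments with common domain; $U[T/x]=\{s[c/x]:c\in T,s\in U\}$, $U[f/x]=\bigcup_{s\in U}\{s[c/x]:c\in f(s)\}$; $\mathit{Rel}(U,(x_1,\dots,x_k))=\{(s(x_1),\dots,s(x_k)):s\in U\}$. Formulas in negation normal form; first-order literals hold in $U$ iff they hold classically under every $s\in U$; $\wedge$ componentwise; $\varphi\vee\psi$ holds in $U$ iff $\varphi$ holds in $U_0$ and $\psi$ in $U_1$ for some $U_0\cup U_1=U$; $\forall x\varphi$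 holds in $U$ iff $\varphi$ holds in $U[A/x]$; $\exists x\varphi$ holds iff $\varphi$ holds in $U[f/x]$ for some $f:U\to\mathcal{P}(A)\setminus\{\emptyset\}$; a sentence is true in $\mathfrak{A}$ iff it holds for the team $\{\emptyset\}$. $\mathrm{D}^+$ is first-order logic in negation normal form extended with dependence atoms $=\!(x_1,\dots,x_k)$ (any $s,t\in U$ agreeing on $x_1..x_{k-1}$ agree on $x_k$), inclusion atoms $\overline{x}\subseteq\overline{z}$ ($\mathit{Rel}(U,\overline{x})\subseteq\mathit{Rel}(U,\overline{z})$), exclusion atoms $\overline{x}\,|\,\overline{z}$ ($\mathit{Rel}(U,\overline{x})\cap\mathit{Rel}(U,\overline{z})=\emptyset$), and independence atoms $\overline{x}\perp_{\overline{z}}\overline{w}$ (for all $s,s'\in U$ with $s(\overline{z})=s'(\overline{z})$ there is $t\in U$ with $t(\overline{x})=s(\overline{x})$, $t(\overline{z})=s(\overline{z})$, $t(\overline{w})=s'(\overline{w})$) and $\overline{x}\perp\overline{w}$ (same with $\overline{z}$ empty). $\mathrm{D}^*$ extends $\mathrm{D}^+$ by the rule: if $\varphi$ is a formula, so is $\mathrm{I}x\,\varphi$, with $\mathfrak{A},U\models\mathrm{I}x\,\varphi$ iff there is a finite nonempty set $S$ with $S\cap A=\emptyset$ such that $\mathfrak{A}+S,U[S/x]\models\varphi$, where $\mathfrak{A}+S$ has domain $A\cup S$ and the same relations as $\mathfrak{A}$. -}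

module Defs where

open import Data.Nat using (ℕ; zero; suc; _+_)
open import Data.Fin using (Fin; zero; suc; splitAt; inject+)
open import Data.Vec using (Vec; []; _∷_; lookup; map; head; tail)
open import Data.List using (List; []; _∷_; _++_; length)
import Data.List as L
open import Data.Bool using (Bool; true; false; T; _∧_)
open import Data.Maybe using (Maybe; just; nothing)
open import Data.Sum using (_⊎_; inj₁; inj₂)
open import Data.Product using (Σ; ∃; _×_; _,_)
open import Data.Unit using (⊤; tt)
open import Relation.Binary.PropositionalEquality using (_≡_; _≢_)
open import Relation.Nullary using (¬_)

-- A finite relational vocabulary: the list of arities of its symbols.
-- Symbol i of τ is an index  i : Fin (length τ), of arity  L.lookup τ i.
Vocab : Set
Vocab = List ℕ

Sym : Vocab → Set
Sym τ = Fin (length τ)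

arity : (τ : Vocab) → Sym τ → ℕ
arity τ i = L.lookup τ i

Rel : ℕ → ℕ → Set
Rel m a = Vec (Fin m) a → Bool

Struct : Vocab → ℕ → Set
Struct [] m = ⊤
Struct (a ∷ σ) m = Rel m a × Struct σ m

interp : {σ : Vocab} {m : ℕ} → Struct σ m → (i : Sym σ) → Rel m (arity σ i)
interp {a ∷ σ} (R , M) zero = R
interp {a ∷ σ} (R , M) (suc i) = interp M i

expand : {as τ : Vocab} {m : ℕ} → Struct as m → Struct τ m → Struct (as ++ τ) m
expand {[]} tt M = M
expand {a ∷ as} (R , Rs) M = R , expand Rs M

-- Adding a finite set S = Fin k of new elements (disjoint from A = Fin m).
-- Domain of A + S is Fin (m + k); element  inject+ k a  is the old a,
-- the elements in the image of  raise m  form S.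

toOld : {m k : ℕ} → Fin (m + k) → Maybe (Fin m)
toOld {m} {k} c with splitAt m c
... | inj₁ a = just a
... | inj₂ _ = nothing

isNew : {m k : ℕ} → Fin (m + k) → Bool
isNew {m} {k} c with splitAt m c
... | inj₁ _ = false
... | inj₂ _ = true

restrictV : {m k n : ℕ} → Vec (Fin (m + k)) n → Maybe (Vec (Fin m) n)
restrictV [] = just []
restrictV {m} {k} (c ∷ cs) with toOld {m} {k} c | restrictV {m} {k} cs
... | just a | just as = just (a ∷ as)
... | _      | _       = nothing

extRel : {m k a : ℕ} → Rel m a → Rel (m + k) a
extRel {m} {k} R cs with restrictV {m} {k} cs
... | just as = R as
... | nothing = false

_+S_ : {σ : Vocab} {m : ℕ} → Struct σ m → (k : ℕ) → Struct σ (m + k)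
_+S_ {[]} tt k = tt
_+S_ {a ∷ σ} (R , M) k = extRel {k = k} R , (M +S k)

-- First-order logic (well-scoped, de Bruijn: variable zero is the most
-- recently bound one).  FO σ n = formulas with n variables in scope.

data FO (σ : Vocab) (n : ℕ) : Set where
  rel  : (i : Sym σ) → Vec (Fin n) (arity σ i) → FO σ n
  eq   : Fin n → Fin n → FO σ n
  neg  : FO σ n → FO σ n
  and  : FO σ n → FO σ n → FO σ n
  or   : FO σ n → FO σ n → FO σ n
  all  : FO σ (suc n) → FO σ n
  ex   : FO σ (suc n) → FO σ n

vals : {m n k : ℕ} → Vec (Fin m) n → Vec (Fin n) k → Vec (Fin m) k
vals s xs = map (lookup s) xs

FOSat : {σ : Vocab} {m n : ℕ} → Struct σ m → FO σ n → Vec (Fin m) n → Set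
FOSat M (rel i xs) s = T (interp M i (vals s xs))
FOSat M (eq x y) s = lookup s x ≡ lookup s y
FOSat M (neg φ) s = ¬ FOSat M φ s
FOSat M (and φ ψ) s = FOSat M φ s × FOSat M ψ s
FOSat M (or φ ψ) s = FOSat M φ s ⊎ FOSat M ψ s
FOSat {m = m} M (all φ) s = (c : Fin m) → FOSat M φ (c ∷ s)
FOSat {m = m} M (ex φ) s = Σ (Fin m) λ c → FOSat M φ (c ∷ s)

-- ESO σ-sentence  ∃X₁⋯∃X_k ψ : the arities of X₁..X_k and a FO sentence
-- over σ ∪ {X₁..X_k}.
record ESO (σ : Vocab) : Set where
  constructor ∃SO
  field
    arities : List ℕ
    body    : FO (arities ++ σ) 0

ESOTrue : {σ : Vocab} {m : ℕ} → Struct σ m → ESO σ → Set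
ESOTrue {m = m} M (∃SO as ψ) = Σ (Struct as m) λ Xs → FOSat (expand Xs M) ψ []

-- L_RE τ-sentence  I Y ψ : ψ an ESO sentence over τ ∪ {Y}, Y a fresh
-- unary symbol (the first symbol of the vocabulary  1 ∷ τ).
LRE : Vocab → Set
LRE τ = ESO (1 ∷ τ)

YRel : {m k : ℕ} → Rel (m + k) 1
YRel {m} {k} (c ∷ []) = isNew {m} {k} c

-- 𝔄 ⊨ I Y ψ  iff for some finite nonempty S (of size suc k) disjoint
-- from A, (𝔄 + S, Y := S) ⊨ ψ.
LRETrue : {τ : Vocab} {m : ℕ} → Struct τ m → LRE τ → Set
LRETrue {m = m} M ψ = Σ ℕ λ k → ESOTrue {m = m + suc k} (YRel {m} {suc k} , (M +S suc k)) ψ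

-- D* (= D⁺ with the I quantifier), well-scoped, in negation normal form

data DStar (τ : Vocab) (n : ℕ) : Set where
  rel   : (i : Sym τ) → Vec (Fin n) (arity τ i) → DStar τ n
  nrel  : (i : Sym τ) → Vec (Fin n) (arity τ i) → DStar τ n
  eq    : Fin n → Fin n → DStar τ n
  neq   : Fin n → Fin n → DStar τ n
  -- dependence atom  =(x₁,…,x_{k-1},x_k) : dep (x₁…x_{k-1}) x_k
  dep   : {k : ℕ} → Vec (Fin n) k → Fin n → DStar τ n
  inc   : {k : ℕ} → Vec (Fin n) k → Vec (Fin n) k → DStar τ n
  exc   : {k : ℕ} → Vec (Fin n) k → Vec (Fin n) k → DStar τ n
  -- independence atom  x̄ ⊥_z̄ w̄ : ind x̄ z̄ w̄  (x̄ ⊥ w̄ is ind x̄ [] w̄)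
  ind   : {a b c : ℕ} → Vec (Fin n) a → Vec (Fin n) b → Vec (Fin n) c → DStar τ n
  and   : DStar τ n → DStar τ n → DStar τ n
  or    : DStar τ n → DStar τ n → DStar τ n
  all   : DStar τ (suc n) → DStar τ n
  ex    : DStar τ (suc n) → DStar τ n
  I     : DStar τ (suc n) → DStar τ n

-- A team over domain Fin m with n variables: a (decidable) set of
-- assignments  s : Vec (Fin m) n  (s lookup x = s(x)).
Team : ℕ → ℕ → Set
Team m n = Vec (Fin m) n → Bool

_∈_ : {m n : ℕ} → Vec (Fin m) n → Team m n → Set
s ∈ U = T (U s)

-- U[S/x] for the I quantifier: team over A ∪ S; x ranges over S, the
-- other variables as in U.
liftTeamS : {m k n : ℕ} → Team m n → Team (m + k) (suc n)
liftTeamS {m} {k} U (c ∷ s) with restrictV {m} {k} s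
... | just s₀ = isNew {m} {k} c ∧ U s₀
... | nothing = false

DSat : {τ : Vocab} {m n : ℕ} → Struct τ m → DStar τ n → Team m n → Set
DSat M (rel i xs) U = ∀ s → s ∈ U → T (interp M i (vals s xs))
DSat M (nrel i xs) U = ∀ s → s ∈ U → ¬ T (interp M i (vals s xs))
DSat M (eq x y) U = ∀ s → s ∈ U → lookup s x ≡ lookup s y
DSat M (neq x y) U = ∀ s → s ∈ U → lookup s x ≢ lookup s y
DSat M (dep xs y) U =
  ∀ s t → s ∈ U → t ∈ U → vals s xs ≡ vals t xs → lookup s y ≡ lookup t y
DSat M (inc xs zs) U =
  ∀ s → s ∈ U → Σ _ λ t → t ∈ U × vals s xs ≡ vals t zs
DSat M (exc xs zs) U =
  ∀ s t → s ∈ U → t ∈ U → vals s xs ≢ vals t zs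
DSat M (ind xs zs ws) U =
  ∀ s s′ → s ∈ U → s′ ∈ U → vals s zs ≡ vals s′ zs →
    Σ _ λ t → t ∈ U × vals t xs ≡ vals s xs × vals t zs ≡ vals s zs
                    × vals t ws ≡ vals s′ ws
DSat M (and φ ψ) U = DSat M φ U × DSat M ψ U
-- lax disjunction: U = U₀ ∪ U₁
DSat {m = m} {n = n} M (or φ ψ) U =
  Σ (Team m n) λ U₀ → Σ (Team m n) λ U₁ →
    (∀ s → s ∈ U → s ∈ U₀ ⊎ s ∈ U₁) ×
    (∀ s → s ∈ U₀ → s ∈ U) × (∀ s → s ∈ U₁ → s ∈ U) ×
    DSat M φ U₀ × DSat M ψ U₁
DSat M (all φ) U = DSat M φ (λ t → U (tail t))
DSat {m = m} {n = n} M (ex φ) U =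
  Σ (Vec (Fin m) n → Fin m → Bool) λ f →
    (∀ s → s ∈ U → Σ (Fin m) λ c → T (f s c)) ×
    DSat M φ (λ t → U (tail t) ∧ f (tail t) (head t))
DSat {m = m} M (I φ) U =
  Σ ℕ λ k → DSat (M +S suc k) φ (liftTeamS {m} {suc k} U)

-- truth of a D* sentence: the team {∅}
DTrue : {τ : Vocab} {m : ℕ} → Struct τ m → DStar τ 0 → Set
DTrue M φ = DSat M φ (λ _ → true)

-- A D* formula is translated into first-order logic over τ, the unary Y and
-- fresh relation symbols: each subformula gets a relation coding the team on
-- which it is evaluated, and a unary predicate for the current domain; the
-- clauses of lax team semantics become first-order constraints between these.
-- Each I x enlarges the domain by a nonempty set of points taken from Y, so a
-- single finite S, large enough for all I's of a derivation, serves them all.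
-- Quantifying the auxiliary relations existentially yields an ESO sentence over
-- τ ∪ {Y}, that is, an L_RE sentence I Y ψ.

module Submission where

open import Defs
open import Data.Nat as ℕ using (ℕ; zero; suc; _+_; _≤_; _<_; _<ᵇ_; _⊔_)
import Data.Nat.Properties as ℕₚ
open import Data.Fin using (Fin; zero; suc; splitAt; _↑ˡ_; _↑ʳ_; toℕ; fromℕ<; inject≤)
import Data.Fin.Properties as Finₚ
open import Data.Vec as Vec using (Vec; []; _∷_; lookup; head; tail; _++_; allFin)
import Data.Vec.Properties as Vecₚ
import Data.Vec.Functional as Vector
import Data.Vec.Functional.Properties as Vectorₚ
import Data.List as List
open import Data.Bool using (Bool; true; false; T; _∧_; not)
open import Data.Bool.Properties using (T-∧; T-≡)
open import Data.Maybe using (Maybe; just; nothing)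
open import Data.Sum using (_⊎_; inj₁; inj₂)
open import Data.Product using (Σ; _×_; _,_; proj₁; proj₂)
open import Data.Unit using (⊤; tt)
open import Data.Empty using (⊥-elim)
open import Function.Bundles using (_⇔_; mk⇔; Equivalence)
open import Relation.Binary.PropositionalEquality
open import Relation.Nullary using (¬_; Dec; yes; no)
open import Relation.Nullary.Decidable using (T?; _×-dec_; ¬?)

open Equivalence using (to; from)

T-∧-intro : ∀ {a b} → T a → T b → T (a ∧ b)
T-∧-intro ta tb = T-∧ .from (ta , tb)

T-∧-fst : ∀ {a b} → T (a ∧ b) → T a
T-∧-fst t = proj₁ (T-∧ .to t)

T-∧-snd : ∀ {a b} → T (a ∧ b) → T b
T-∧-snd {a} t = proj₂ (T-∧ {a} .to t)

¬T⇒T-not : ∀ {a} → ¬ T a → T (not a)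
¬T⇒T-not {true} ¬t = ¬t tt
¬T⇒T-not {false} _ = tt

T-not⇒¬T : ∀ {a} → T (not a) → ¬ T a
T-not⇒¬T {true} () _

¬T-false : ∀ {a} → a ≡ false → ¬ T a
¬T-false refl ()

modus-ponens : ∀ {A B : Set} → (¬ A) ⊎ B → A → B
modus-ponens (inj₁ ¬a) a = ⊥-elim (¬a a)
modus-ponens (inj₂ b) _ = b

implication : ∀ {A B : Set} → Dec A → (A → B) → (¬ A) ⊎ B
implication (yes a) f = inj₂ (f a)
implication (no ¬a) _ = inj₁ ¬a

map-injective : ∀ {A B : Set} {n} (f : A → B) → (∀ x y → f x ≡ f y → x ≡ y) →
  (xs ys : Vec A n) → Vec.map f xs ≡ Vec.map f ys → xs ≡ ys
map-injective f f-inj [] [] _ = refl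
map-injective f f-inj (x ∷ xs) (y ∷ ys) p =
  cong₂ _∷_ (f-inj x y (Vecₚ.∷-injectiveˡ p)) (map-injective f f-inj xs ys (Vecₚ.∷-injectiveʳ p))

map-preimage : ∀ {A B : Set} {n} (f : A → B) (ys : Vec B n) →
  (∀ j → Σ A λ x → f x ≡ lookup ys j) → Σ (Vec A n) λ xs → Vec.map f xs ≡ ys
map-preimage f [] _ = [] , refl
map-preimage f (y ∷ ys) pre with pre zero | map-preimage f ys (λ j → pre (suc j))
... | x , fx≡y | xs , fxs≡ys = x ∷ xs , cong₂ _∷_ fx≡y fxs≡ys

vals-map : ∀ {M N n j} (f : Fin M → Fin N) (s : Vec (Fin M) n) (xs : Vec (Fin n) j) →
  vals (Vec.map f s) xs ≡ Vec.map f (vals s xs)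
vals-map f s [] = refl
vals-map f s (x ∷ xs) = cong₂ _∷_ (Vecₚ.lookup-map x f s) (vals-map f s xs)

vals-↑ˡ : ∀ {N n k j} (v : Vec (Fin N) n) (s : Vec (Fin N) k) (xs : Vec (Fin n) j) →
  vals (v ++ s) (Vec.map (_↑ˡ k) xs) ≡ vals v xs
vals-↑ˡ v s [] = refl
vals-↑ˡ v s (x ∷ xs) = cong₂ _∷_ (Vecₚ.lookup-++ˡ v s x) (vals-↑ˡ v s xs)

vals-↑ʳ : ∀ {N n k j} (v : Vec (Fin N) n) (s : Vec (Fin N) k) (xs : Vec (Fin k) j) →
  vals (v ++ s) (Vec.map (n ↑ʳ_) xs) ≡ vals s xs
vals-↑ʳ v s [] = refl
vals-↑ʳ v s (x ∷ xs) = cong₂ _∷_ (Vecₚ.lookup-++ʳ v s x) (vals-↑ʳ v s xs)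

vals-suc : ∀ {N n j} (c : Fin N) (s : Vec (Fin N) n) (xs : Vec (Fin n) j) →
  vals (c ∷ s) (Vec.map suc xs) ≡ vals s xs
vals-suc c s [] = refl
vals-suc c s (x ∷ xs) = cong (lookup s x ∷_) (vals-suc c s xs)

vals-allFin : ∀ {N n} (v : Vec (Fin N) n) → vals v (allFin n) ≡ v
vals-allFin = Vecₚ.map-lookup-allFin

data OldOrNew (m k : ℕ) : Fin (m + k) → Set where
  old : (x : Fin m) → OldOrNew m k (x ↑ˡ k)
  new : (j : Fin k) → OldOrNew m k (m ↑ʳ j)

oldOrNew : ∀ m k (c : Fin (m + k)) → OldOrNew m k c
oldOrNew m k c with splitAt m c in split≡
... | inj₁ x = subst (OldOrNew m k) (Finₚ.splitAt⁻¹-↑ˡ split≡) (old x)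
... | inj₂ j = subst (OldOrNew m k) (Finₚ.splitAt⁻¹-↑ʳ split≡) (new j)

module _ {m k : ℕ} where

  toOld-↑ˡ : (x : Fin m) → toOld {m} {k} (x ↑ˡ k) ≡ just x
  toOld-↑ˡ x rewrite Finₚ.splitAt-↑ˡ m x k = refl

  toOld≡just : (c : Fin (m + k)) {x : Fin m} → toOld {m} {k} c ≡ just x → c ≡ x ↑ˡ k
  toOld≡just c p with splitAt m c in split≡
  toOld≡just c refl | inj₁ x = sym (Finₚ.splitAt⁻¹-↑ˡ split≡)

  toOld≡nothing : (c : Fin (m + k)) → toOld {m} {k} c ≡ nothing → Σ (Fin k) λ j → c ≡ m ↑ʳ j
  toOld≡nothing c p with splitAt m c in split≡
  toOld≡nothing c () | inj₁ x
  toOld≡nothing c p | inj₂ j = j , sym (Finₚ.splitAt⁻¹-↑ʳ split≡)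

  isNew-↑ˡ : (x : Fin m) → isNew {m} {k} (x ↑ˡ k) ≡ false
  isNew-↑ˡ x rewrite Finₚ.splitAt-↑ˡ m x k = refl

  isNew-↑ʳ : (j : Fin k) → T (isNew {m} {k} (m ↑ʳ j))
  isNew-↑ʳ j rewrite Finₚ.splitAt-↑ʳ m k j = tt

  isNew⇒new : (c : Fin (m + k)) → T (isNew {m} {k} c) → Σ (Fin k) λ j → c ≡ m ↑ʳ j
  isNew⇒new c t with oldOrNew m k c
  ... | old x = ⊥-elim (¬T-false (isNew-↑ˡ x) t)
  ... | new j = j , refl

  ¬isNew⇒old : (c : Fin (m + k)) → ¬ T (isNew {m} {k} c) → Σ (Fin m) λ x → c ≡ x ↑ˡ k
  ¬isNew⇒old c nt with oldOrNew m k c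
  ... | old x = x , refl
  ... | new j = ⊥-elim (nt (isNew-↑ʳ j))

  isNew⇒≤toℕ : (c : Fin (m + k)) → T (isNew {m} {k} c) → m ≤ toℕ c
  isNew⇒≤toℕ c t with oldOrNew m k c
  ... | old x = ⊥-elim (¬T-false (isNew-↑ˡ x) t)
  ... | new j = subst (m ≤_) (sym (Finₚ.toℕ-↑ʳ m j)) (ℕₚ.m≤m+n m _)

  ≤toℕ⇒isNew : (c : Fin (m + k)) → m ≤ toℕ c → T (isNew {m} {k} c)
  ≤toℕ⇒isNew c m≤c with oldOrNew m k c
  ... | old x = ⊥-elim (ℕₚ.<⇒≱ (subst (_< m) (sym (Finₚ.toℕ-↑ˡ x k)) (Finₚ.toℕ<n x)) m≤c)
  ... | new j = isNew-↑ʳ j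

  restrictV-↑ˡ : ∀ {n} (w : Vec (Fin m) n) → restrictV {m} {k} (Vec.map (_↑ˡ k) w) ≡ just w
  restrictV-↑ˡ [] = refl
  restrictV-↑ˡ (x ∷ w) rewrite toOld-↑ˡ x | restrictV-↑ˡ w = refl

  restrictV≡just : ∀ {n} (v : Vec (Fin (m + k)) n) {w} → restrictV {m} {k} v ≡ just w →
    v ≡ Vec.map (_↑ˡ k) w
  restrictV≡just [] refl = refl
  restrictV≡just (c ∷ v) p with toOld {m} {k} c in c≡ | restrictV {m} {k} v in v≡
  restrictV≡just (c ∷ v) refl | just _ | just _ = cong₂ _∷_ (toOld≡just c c≡) (restrictV≡just v v≡)

  restrictV≡nothing : ∀ {n} (v : Vec (Fin (m + k)) n) → restrictV {m} {k} v ≡ nothing →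
    Σ (Fin n) λ i → Σ (Fin k) λ j → lookup v i ≡ m ↑ʳ j
  restrictV≡nothing (c ∷ v) p with toOld {m} {k} c in c≡ | restrictV {m} {k} v in v≡
  restrictV≡nothing (c ∷ v) () | just _ | just _
  restrictV≡nothing (c ∷ v) p | just _ | nothing with restrictV≡nothing v v≡
  ... | i , j , p = suc i , j , p
  restrictV≡nothing (c ∷ v) p | nothing | _ with toOld≡nothing c c≡
  ... | j , p = zero , j , p

  restrictV-isNew : ∀ {n} (v : Vec (Fin (m + k)) n) (i : Fin n) → T (isNew {m} {k} (lookup v i)) →
    restrictV {m} {k} v ≡ nothing
  restrictV-isNew v i t with restrictV {m} {k} v in r≡
  ... | nothing = refl
  ... | just w with restrictV≡just v r≡
  ... | refl rewrite Vecₚ.lookup-map i (_↑ˡ k) w = ⊥-elim (¬T-false (isNew-↑ˡ (lookup w i)) t)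

  extRel-↑ˡ : ∀ {a} (R : Rel m a) (w : Vec (Fin m) a) → extRel {m} {k} R (Vec.map (_↑ˡ k) w) ≡ R w
  extRel-↑ˡ R w rewrite restrictV-↑ˡ w = refl

  extRel-isNew : ∀ {a} (R : Rel m a) (v : Vec (Fin (m + k)) a) (i : Fin a) →
    T (isNew {m} {k} (lookup v i)) → extRel {m} {k} R v ≡ false
  extRel-isNew R v i t rewrite restrictV-isNew v i t = refl

  liftTeamS⇒ : ∀ {n} (U : Team m n) c (s : Vec (Fin (m + k)) n) → T (liftTeamS {m} {k} U (c ∷ s)) →
    Σ (Vec (Fin m) n) λ s₀ → (s ≡ Vec.map (_↑ˡ k) s₀) × T (isNew {m} {k} c) × T (U s₀)
  liftTeamS⇒ U c s t with restrictV {m} {k} s in r≡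
  ... | just s₀ = s₀ , restrictV≡just s r≡ , T-∧-fst t , T-∧-snd {isNew {m} {k} c} t

  liftTeamS⇐ : ∀ {n} (U : Team m n) c (s₀ : Vec (Fin m) n) → T (isNew {m} {k} c) → T (U s₀) →
    T (liftTeamS {m} {k} U (c ∷ Vec.map (_↑ˡ k) s₀))
  liftTeamS⇐ U c s₀ t u rewrite restrictV-↑ˡ s₀ = T-∧-intro t u

interp-+S : ∀ {σ m} (M : Struct σ m) k (i : Sym σ) → interp (M +S k) i ≡ extRel {k = k} (interp M i)
interp-+S {_ List.∷ σ} (R , M) k zero = refl
interp-+S {_ List.∷ σ} (R , M) k (suc i) = interp-+S M k i

data Ref : Vocab → ℕ → Set where
  here  : ∀ {a σ} → Ref (a List.∷ σ) a
  there : ∀ {a b σ} → Ref σ a → Ref (b List.∷ σ) a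

relOf : ∀ {σ N a} → Struct σ N → Ref σ a → Rel N a
relOf (R , _) here = R
relOf (_ , M) (there r) = relOf M r

symOf : ∀ {σ a} → Ref σ a → Sym σ
symOf here = zero
symOf (there r) = suc (symOf r)

arity-symOf : ∀ {σ a} (r : Ref σ a) → a ≡ arity σ (symOf r)
arity-symOf here = refl
arity-symOf (there r) = arity-symOf r

refOf : ∀ {σ} (i : Sym σ) → Ref σ (arity σ i)
refOf {_ List.∷ σ} zero = here
refOf {_ List.∷ σ} (suc i) = there (refOf i)

relOf-refOf : ∀ {σ N} (M : Struct σ N) (i : Sym σ) v → relOf M (refOf i) v ≡ interp M i v
relOf-refOf {_ List.∷ σ} (R , M) zero v = refl
relOf-refOf {_ List.∷ σ} (R , M) (suc i) v = relOf-refOf M i v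

weakenʳ : ∀ {as a} bs → Ref as a → Ref (as List.++ bs) a
weakenʳ bs here = here
weakenʳ bs (there r) = there (weakenʳ bs r)

weakenˡ : ∀ {bs a} as → Ref bs a → Ref (as List.++ bs) a
weakenˡ List.[] r = r
weakenˡ (_ List.∷ as) r = there (weakenˡ as r)

relOf-weakenʳ : ∀ {as bs N a} (X : Struct as N) (M : Struct bs N) (r : Ref as a) v →
  relOf (expand X M) (weakenʳ bs r) v ≡ relOf X r v
relOf-weakenʳ (R , X) M here v = refl
relOf-weakenʳ (R , X) M (there r) v = relOf-weakenʳ X M r v

relOf-weakenˡ : ∀ {as bs N a} (X : Struct as N) (M : Struct bs N) (r : Ref bs a) v →
  relOf (expand X M) (weakenˡ as r) v ≡ relOf M r v
relOf-weakenˡ {List.[]} X M r v = refl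
relOf-weakenˡ {_ List.∷ as} (R , X) M r v = relOf-weakenˡ X M r v

atom : ∀ {σ a n} → Ref σ a → Vec (Fin n) a → FO σ n
atom {n = n} r xs = rel (symOf r) (subst (Vec (Fin n)) (arity-symOf r) xs)

vals-subst : ∀ {N n a b} (s : Vec (Fin N) n) (p : a ≡ b) (xs : Vec (Fin n) a) →
  vals s (subst (Vec (Fin n)) p xs) ≡ subst (Vec (Fin N)) p (vals s xs)
vals-subst s refl xs = refl

interp-symOf : ∀ {σ a N} (M : Struct σ N) (r : Ref σ a) (v : Vec (Fin N) a) →
  interp M (symOf r) (subst (Vec (Fin N)) (arity-symOf r) v) ≡ relOf M r v
interp-symOf (R , M) here v = refl
interp-symOf (R , M) (there r) v = interp-symOf M r v

FOSat-atom : ∀ {σ a n N} (M : Struct σ N) (r : Ref σ a) (xs : Vec (Fin n) a) (s : Vec (Fin N) n) →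
  FOSat M (atom r xs) s ≡ T (relOf M r (vals s xs))
FOSat-atom M r xs s rewrite vals-subst s (arity-symOf r) xs = cong T (interp-symOf M r (vals s xs))

⊤ᶠ : ∀ {σ n} → FO σ n
⊤ᶠ = all (eq zero zero)

_⇒ᶠ_ : ∀ {σ n} → FO σ n → FO σ n → FO σ n
φ ⇒ᶠ ψ = or (neg φ) ψ

∀ⁿ : ∀ {σ} n {k} → FO σ (n + k) → FO σ k
∀ⁿ zero φ = φ
∀ⁿ (suc n) φ = ∀ⁿ n (all φ)

∃ⁿ : ∀ {σ} n {k} → FO σ (n + k) → FO σ k
∃ⁿ zero φ = φ
∃ⁿ (suc n) φ = ∃ⁿ n (ex φ)

⋀ : ∀ {σ k} n → (Fin n → FO σ k) → FO σ k
⋀ zero φ = ⊤ᶠ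
⋀ (suc n) φ = and (φ zero) (⋀ n (λ j → φ (suc j)))

_≐_ : ∀ {σ n j} → Vec (Fin n) j → Vec (Fin n) j → FO σ n
[] ≐ [] = ⊤ᶠ
(x ∷ xs) ≐ (y ∷ ys) = and (eq x y) (xs ≐ ys)

module FOSatProperties {σ N} (M : Struct σ N) where

  ∀ⁿ⇒ : ∀ n {k} (φ : FO σ (n + k)) {s : Vec (Fin N) k} →
    FOSat M (∀ⁿ n φ) s → ∀ v → FOSat M φ (v ++ s)
  ∀ⁿ⇒ zero φ h [] = h
  ∀ⁿ⇒ (suc n) φ h (c ∷ v) = ∀ⁿ⇒ n (all φ) h v c

  ∀ⁿ⇐ : ∀ n {k} (φ : FO σ (n + k)) {s : Vec (Fin N) k} →
    (∀ v → FOSat M φ (v ++ s)) → FOSat M (∀ⁿ n φ) s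
  ∀ⁿ⇐ zero φ h = h []
  ∀ⁿ⇐ (suc n) φ h = ∀ⁿ⇐ n (all φ) (λ v c → h (c ∷ v))

  ∃ⁿ⇒ : ∀ n {k} (φ : FO σ (n + k)) {s : Vec (Fin N) k} →
    FOSat M (∃ⁿ n φ) s → Σ (Vec (Fin N) n) λ v → FOSat M φ (v ++ s)
  ∃ⁿ⇒ zero φ h = [] , h
  ∃ⁿ⇒ (suc n) φ h with ∃ⁿ⇒ n (ex φ) h
  ... | v , c , h′ = c ∷ v , h′

  ∃ⁿ⇐ : ∀ n {k} (φ : FO σ (n + k)) {s : Vec (Fin N) k} (v : Vec (Fin N) n) →
    FOSat M φ (v ++ s) → FOSat M (∃ⁿ n φ) s
  ∃ⁿ⇐ zero φ [] h = h
  ∃ⁿ⇐ (suc n) φ (c ∷ v) h = ∃ⁿ⇐ n (ex φ) v (c , h)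

  ⋀⇒ : ∀ {k} n (φ : Fin n → FO σ k) {s} → FOSat M (⋀ n φ) s → ∀ j → FOSat M (φ j) s
  ⋀⇒ (suc n) φ (h , _) zero = h
  ⋀⇒ (suc n) φ (_ , h) (suc j) = ⋀⇒ n (λ j → φ (suc j)) h j

  ⋀⇐ : ∀ {k} n (φ : Fin n → FO σ k) {s} → (∀ j → FOSat M (φ j) s) → FOSat M (⋀ n φ) s
  ⋀⇐ zero φ h = λ _ → refl
  ⋀⇐ (suc n) φ h = h zero , ⋀⇐ n (λ j → φ (suc j)) (λ j → h (suc j))

  ≐⇒ : ∀ {n j} (xs ys : Vec (Fin n) j) {s} → FOSat M (xs ≐ ys) s → vals s xs ≡ vals s ys
  ≐⇒ [] [] h = refl
  ≐⇒ (x ∷ xs) (y ∷ ys) (h , h′) = cong₂ _∷_ h (≐⇒ xs ys h′)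

  ≐⇐ : ∀ {n j} (xs ys : Vec (Fin n) j) {s} → vals s xs ≡ vals s ys → FOSat M (xs ≐ ys) s
  ≐⇐ [] [] h = λ _ → refl
  ≐⇐ (x ∷ xs) (y ∷ ys) h = Vecₚ.∷-injectiveˡ h , ≐⇐ xs ys (Vecₚ.∷-injectiveʳ h)

  ≐? : ∀ {n j} (xs ys : Vec (Fin n) j) {s} → Dec (FOSat M (xs ≐ ys) s)
  ≐? xs ys {s} with Vecₚ.≡-dec Finₚ._≟_ (vals s xs) (vals s ys)
  ... | yes p = yes (≐⇐ xs ys p)
  ... | no ¬p = no (λ h → ¬p (≐⇒ xs ys h))

  atom? : ∀ {k a} (r : Ref σ a) (xs : Vec (Fin k) a) {s} → Dec (FOSat M (atom r xs) s)
  atom? r xs {s} rewrite FOSat-atom M r xs s = T? _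

  atom⇐ : ∀ {k a} (r : Ref σ a) (xs : Vec (Fin k) a) s {w} → vals s xs ≡ w →
    T (relOf M r w) → FOSat M (atom r xs) s
  atom⇐ r xs s refl t = subst (λ P → P) (sym (FOSat-atom M r xs s)) t

  atom⇒ : ∀ {k a} (r : Ref σ a) (xs : Vec (Fin k) a) s {w} → vals s xs ≡ w →
    FOSat M (atom r xs) s → T (relOf M r w)
  atom⇒ r xs s refl h = subst (λ P → P) (FOSat-atom M r xs s) h

-- Auxiliary relations of a D* formula: a team relation for every subformula
-- below a connective that changes the team, and a domain predicate below each I.

module AuxiliaryRelations (τ : Vocab) where

  Slots : (F : ℕ → Set) → ∀ {n} → DStar τ n → Set
  Slots F (rel i xs) = ⊤
  Slots F (nrel i xs) = ⊤
  Slots F (eq x y) = ⊤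
  Slots F (neq x y) = ⊤
  Slots F (dep xs y) = ⊤
  Slots F (inc xs zs) = ⊤
  Slots F (exc xs zs) = ⊤
  Slots F (ind xs zs ws) = ⊤
  Slots F (and φ ψ) = Slots F φ × Slots F ψ
  Slots F {n} (or φ ψ) = F n × F n × Slots F φ × Slots F ψ
  Slots F {n} (all φ) = F (suc n) × Slots F φ
  Slots F {n} (ex φ) = F (suc n) × Slots F φ
  Slots F {n} (I φ) = F (suc n) × F 1 × Slots F φ

  mapSlots : ∀ {F G : ℕ → Set} (f : ∀ {a} → F a → G a) → ∀ {n} (φ : DStar τ n) → Slots F φ → Slots G φ
  mapSlots f (rel i xs) _ = tt
  mapSlots f (nrel i xs) _ = tt
  mapSlots f (eq x y) _ = tt
  mapSlots f (neq x y) _ = tt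
  mapSlots f (dep xs y) _ = tt
  mapSlots f (inc xs zs) _ = tt
  mapSlots f (exc xs zs) _ = tt
  mapSlots f (ind xs zs ws) _ = tt
  mapSlots f (and φ ψ) (L₁ , L₂) = mapSlots f φ L₁ , mapSlots f ψ L₂
  mapSlots f (or φ ψ) (a , b , L₁ , L₂) = f a , f b , mapSlots f φ L₁ , mapSlots f ψ L₂
  mapSlots f (all φ) (a , L) = f a , mapSlots f φ L
  mapSlots f (ex φ) (a , L) = f a , mapSlots f φ L
  mapSlots f (I φ) (a , b , L) = f a , f b , mapSlots f φ L

  auxVocab : ∀ {n} → DStar τ n → Vocab
  auxVocab (rel i xs) = List.[]
  auxVocab (nrel i xs) = List.[]
  auxVocab (eq x y) = List.[]
  auxVocab (neq x y) = List.[]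
  auxVocab (dep xs y) = List.[]
  auxVocab (inc xs zs) = List.[]
  auxVocab (exc xs zs) = List.[]
  auxVocab (ind xs zs ws) = List.[]
  auxVocab (and φ ψ) = auxVocab φ List.++ auxVocab ψ
  auxVocab {n} (or φ ψ) = n List.∷ n List.∷ (auxVocab φ List.++ auxVocab ψ)
  auxVocab {n} (all φ) = suc n List.∷ auxVocab φ
  auxVocab {n} (ex φ) = suc n List.∷ auxVocab φ
  auxVocab {n} (I φ) = suc n List.∷ 1 List.∷ auxVocab φ

  auxRefs : ∀ {n} (φ : DStar τ n) → Slots (Ref (auxVocab φ)) φ
  auxRefs (rel i xs) = tt
  auxRefs (nrel i xs) = tt
  auxRefs (eq x y) = tt
  auxRefs (neq x y) = tt
  auxRefs (dep xs y) = tt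
  auxRefs (inc xs zs) = tt
  auxRefs (exc xs zs) = tt
  auxRefs (ind xs zs ws) = tt
  auxRefs (and φ ψ) =
    mapSlots (weakenʳ (auxVocab ψ)) φ (auxRefs φ) , mapSlots (weakenˡ (auxVocab φ)) ψ (auxRefs ψ)
  auxRefs (or φ ψ) = here , there here ,
    mapSlots (λ r → there (there (weakenʳ (auxVocab ψ) r))) φ (auxRefs φ) ,
    mapSlots (λ r → there (there (weakenˡ (auxVocab φ) r))) ψ (auxRefs ψ)
  auxRefs (all φ) = here , mapSlots there φ (auxRefs φ)
  auxRefs (ex φ) = here , mapSlots there φ (auxRefs φ)
  auxRefs (I φ) = here , there here , mapSlots (λ r → there (there r)) φ (auxRefs φ)

  auxStruct : ∀ {N n} (φ : DStar τ n) → Slots (Rel N) φ → Struct (auxVocab φ) N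
  auxStruct (rel i xs) _ = tt
  auxStruct (nrel i xs) _ = tt
  auxStruct (eq x y) _ = tt
  auxStruct (neq x y) _ = tt
  auxStruct (dep xs y) _ = tt
  auxStruct (inc xs zs) _ = tt
  auxStruct (exc xs zs) _ = tt
  auxStruct (ind xs zs ws) _ = tt
  auxStruct (and φ ψ) (V₁ , V₂) = expand (auxStruct φ V₁) (auxStruct ψ V₂)
  auxStruct (or φ ψ) (a , b , V₁ , V₂) = a , b , expand (auxStruct φ V₁) (auxStruct ψ V₂)
  auxStruct (all φ) (a , V) = a , auxStruct φ V
  auxStruct (ex φ) (a , V) = a , auxStruct φ V
  auxStruct (I φ) (a , b , V) = a , b , auxStruct φ V

  Interprets : ∀ {σ N a} → Struct σ N → Ref σ a → Rel N a → Set
  Interprets M r R = ∀ v → relOf M r v ≡ R v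

  Realises : ∀ {σ N n} (M : Struct σ N) (φ : DStar τ n) → Slots (Ref σ) φ → Slots (Rel N) φ → Set
  Realises M (rel i xs) _ _ = ⊤
  Realises M (nrel i xs) _ _ = ⊤
  Realises M (eq x y) _ _ = ⊤
  Realises M (neq x y) _ _ = ⊤
  Realises M (dep xs y) _ _ = ⊤
  Realises M (inc xs zs) _ _ = ⊤
  Realises M (exc xs zs) _ _ = ⊤
  Realises M (ind xs zs ws) _ _ = ⊤
  Realises M (and φ ψ) (L₁ , L₂) (V₁ , V₂) = Realises M φ L₁ V₁ × Realises M ψ L₂ V₂
  Realises M (or φ ψ) (a , b , L₁ , L₂) (a′ , b′ , V₁ , V₂) =
    Interprets M a a′ × Interprets M b b′ × Realises M φ L₁ V₁ × Realises M ψ L₂ V₂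
  Realises M (all φ) (a , L) (a′ , V) = Interprets M a a′ × Realises M φ L V
  Realises M (ex φ) (a , L) (a′ , V) = Interprets M a a′ × Realises M φ L V
  Realises M (I φ) (a , b , L) (a′ , b′ , V) = Interprets M a a′ × Interprets M b b′ × Realises M φ L V

  Realises-map : ∀ {σ σ′ N n} (f : ∀ {a} → Ref σ a → Ref σ′ a) (M : Struct σ N) (M′ : Struct σ′ N) →
    (∀ {a} (r : Ref σ a) v → relOf M′ (f r) v ≡ relOf M r v) →
    (φ : DStar τ n) (L : Slots (Ref σ) φ) (V : Slots (Rel N) φ) →
    Realises M φ L V → Realises M′ φ (mapSlots f φ L) V
  Realises-map f M M′ hf (rel i xs) L V h = tt
  Realises-map f M M′ hf (nrel i xs) L V h = tt
  Realises-map f M M′ hf (eq x y) L V h = tt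
  Realises-map f M M′ hf (neq x y) L V h = tt
  Realises-map f M M′ hf (dep xs y) L V h = tt
  Realises-map f M M′ hf (inc xs zs) L V h = tt
  Realises-map f M M′ hf (exc xs zs) L V h = tt
  Realises-map f M M′ hf (ind xs zs ws) L V h = tt
  Realises-map f M M′ hf (and φ ψ) (L₁ , L₂) (V₁ , V₂) (h₁ , h₂) =
    Realises-map f M M′ hf φ L₁ V₁ h₁ , Realises-map f M M′ hf ψ L₂ V₂ h₂
  Realises-map f M M′ hf (or φ ψ) (a , b , L₁ , L₂) (_ , _ , V₁ , V₂) (ha , hb , h₁ , h₂) =
    (λ v → trans (hf a v) (ha v)) , (λ v → trans (hf b v) (hb v)) ,
    Realises-map f M M′ hf φ L₁ V₁ h₁ , Realises-map f M M′ hf ψ L₂ V₂ h₂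
  Realises-map f M M′ hf (all φ) (a , L) (_ , V) (ha , h) =
    (λ v → trans (hf a v) (ha v)) , Realises-map f M M′ hf φ L V h
  Realises-map f M M′ hf (ex φ) (a , L) (_ , V) (ha , h) =
    (λ v → trans (hf a v) (ha v)) , Realises-map f M M′ hf φ L V h
  Realises-map f M M′ hf (I φ) (a , b , L) (_ , _ , V) (ha , hb , h) =
    (λ v → trans (hf a v) (ha v)) , (λ v → trans (hf b v) (hb v)) , Realises-map f M M′ hf φ L V h

  auxStruct-realises : ∀ {N n} (φ : DStar τ n) (V : Slots (Rel N) φ) → Realises (auxStruct φ V) φ (auxRefs φ) V
  auxStruct-realises (rel i xs) V = tt
  auxStruct-realises (nrel i xs) V = tt
  auxStruct-realises (eq x y) V = tt
  auxStruct-realises (neq x y) V = tt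
  auxStruct-realises (dep xs y) V = tt
  auxStruct-realises (inc xs zs) V = tt
  auxStruct-realises (exc xs zs) V = tt
  auxStruct-realises (ind xs zs ws) V = tt
  auxStruct-realises (and φ ψ) (V₁ , V₂) =
    Realises-map _ (auxStruct φ V₁) _ (relOf-weakenʳ (auxStruct φ V₁) (auxStruct ψ V₂)) φ _ V₁ (auxStruct-realises φ V₁) ,
    Realises-map _ (auxStruct ψ V₂) _ (relOf-weakenˡ (auxStruct φ V₁) (auxStruct ψ V₂)) ψ _ V₂ (auxStruct-realises ψ V₂)
  auxStruct-realises (or φ ψ) (a , b , V₁ , V₂) = (λ _ → refl) , (λ _ → refl) ,
    Realises-map _ (auxStruct φ V₁) _ (relOf-weakenʳ (auxStruct φ V₁) (auxStruct ψ V₂)) φ _ V₁ (auxStruct-realises φ V₁) ,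
    Realises-map _ (auxStruct ψ V₂) _ (relOf-weakenˡ (auxStruct φ V₁) (auxStruct ψ V₂)) ψ _ V₂ (auxStruct-realises ψ V₂)
  auxStruct-realises (all φ) (a , V) =
    (λ _ → refl) , Realises-map there (auxStruct φ V) _ (λ _ _ → refl) φ _ V (auxStruct-realises φ V)
  auxStruct-realises (ex φ) (a , V) =
    (λ _ → refl) , Realises-map there (auxStruct φ V) _ (λ _ _ → refl) φ _ V (auxStruct-realises φ V)
  auxStruct-realises (I φ) (a , b , V) = (λ _ → refl) , (λ _ → refl) ,
    Realises-map (λ r → there (there r)) (auxStruct φ V) _ (λ _ _ → refl) φ _ V (auxStruct-realises φ V)

-- Over a vocabulary σ containing τ and the unary Y, a team over
-- the current domain is coded by a relation R and the domain by a unary D.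

module Translation (τ σ : Vocab) (τ-ref : (i : Sym τ) → Ref σ (arity τ i)) (Y : Ref σ 1) where
  open AuxiliaryRelations τ

  vars : ∀ n → Vec (Fin (n + 0)) n
  vars n = Vec.map (_↑ˡ 0) (allFin n)

  boundVar : ∀ n → Vec (Fin (suc n + 0)) 1
  boundVar n = head (vars (suc n)) ∷ []

  outerVars : ∀ n → Vec (Fin (suc n + 0)) n
  outerVars n = tail (vars (suc n))

  block₁ : ∀ {n j} → Vec (Fin n) j → Vec (Fin (n + (n + 0))) j
  block₁ {n} xs = Vec.map (_↑ˡ (n + 0)) xs

  block₂ : ∀ {n j} → Vec (Fin n) j → Vec (Fin (n + (n + 0))) j
  block₂ {n} xs = Vec.map (n ↑ʳ_) (Vec.map (_↑ˡ 0) xs)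

  block₁³ : ∀ {n j} → Vec (Fin n) j → Vec (Fin (n + (n + (n + 0)))) j
  block₁³ {n} xs = Vec.map (_↑ˡ (n + (n + 0))) xs

  block₂³ : ∀ {n j} → Vec (Fin n) j → Vec (Fin (n + (n + (n + 0)))) j
  block₂³ {n} xs = Vec.map (n ↑ʳ_) (block₁ xs)

  block₃³ : ∀ {n j} → Vec (Fin n) j → Vec (Fin (n + (n + (n + 0)))) j
  block₃³ {n} xs = Vec.map (n ↑ʳ_) (block₂ xs)

  x₀ : Vec (Fin 1) 1
  x₀ = zero ∷ []

  ∀∈ : ∀ {n} → Ref σ n → FO σ (n + 0) → FO σ 0
  ∀∈ {n} R φ = ∀ⁿ n (atom R (vars n) ⇒ᶠ φ)

  teamWithin : ∀ {n} → Ref σ n → Ref σ 1 → FO σ 0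
  teamWithin {n} R D = ∀∈ R (⋀ n (λ j → atom D ((j ↑ˡ 0) ∷ [])))

  mutual
    translate : ∀ {n} (φ : DStar τ n) → Slots (Ref σ) φ → Ref σ n → Ref σ 1 → FO σ 0
    translate φ L R D = and (teamWithin R D) (translateStep φ L R D)

    translateStep : ∀ {n} (φ : DStar τ n) → Slots (Ref σ) φ → Ref σ n → Ref σ 1 → FO σ 0
    translateStep (rel i xs) L R D = ∀∈ R (atom (τ-ref i) (Vec.map (_↑ˡ 0) xs))
    translateStep (nrel i xs) L R D = ∀∈ R (neg (atom (τ-ref i) (Vec.map (_↑ˡ 0) xs)))
    translateStep (eq x y) L R D = ∀∈ R (eq (x ↑ˡ 0) (y ↑ˡ 0))
    translateStep (neq x y) L R D = ∀∈ R (neg (eq (x ↑ˡ 0) (y ↑ˡ 0)))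
    translateStep {n} (dep xs y) L R D = ∀ⁿ n (∀ⁿ n (
      and (atom R (block₁ (allFin n))) (and (atom R (block₂ (allFin n))) (block₁ xs ≐ block₂ xs))
      ⇒ᶠ eq (y ↑ˡ (n + 0)) (n ↑ʳ (y ↑ˡ 0))))
    translateStep {n} (inc xs zs) L R D =
      ∀∈ R (∃ⁿ n (and (atom R (block₁ (allFin n))) (block₂ xs ≐ block₁ zs)))
    translateStep {n} (exc xs zs) L R D = ∀ⁿ n (∀ⁿ n (
      and (atom R (block₁ (allFin n))) (atom R (block₂ (allFin n)))
      ⇒ᶠ neg (block₁ xs ≐ block₂ zs)))
    translateStep {n} (ind xs zs ws) L R D = ∀ⁿ n (∀ⁿ n (
      and (atom R (block₁ (allFin n))) (and (atom R (block₂ (allFin n))) (block₁ zs ≐ block₂ zs))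
      ⇒ᶠ ∃ⁿ n (and (atom R (block₁³ (allFin n)))
              (and (block₁³ xs ≐ block₂³ xs) (and (block₁³ zs ≐ block₂³ zs) (block₁³ ws ≐ block₃³ ws))))))
    translateStep (and φ ψ) (L₁ , L₂) R D = and (translate φ L₁ R D) (translate ψ L₂ R D)
    translateStep {n} (or φ ψ) (R₀ , R₁ , L₁ , L₂) R D =
      and (∀∈ R (or (atom R₀ (vars n)) (atom R₁ (vars n))))
      (and (∀∈ R₀ (atom R (vars n)))
      (and (∀∈ R₁ (atom R (vars n)))
      (and (translate φ L₁ R₀ D) (translate ψ L₂ R₁ D))))
    translateStep {n} (all φ) (R′ , L) R D =
      and (∀∈ R′ (and (atom R (outerVars n)) (atom D (boundVar n))))
      (and (∀ⁿ (suc n) (and (atom R (outerVars n)) (atom D (boundVar n)) ⇒ᶠ atom R′ (vars (suc n))))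
      (translate φ L R′ D))
    translateStep {n} (ex φ) (R′ , L) R D =
      and (∀∈ R′ (atom R (outerVars n)))
      (and (∀∈ R (ex (atom R′ (zero ∷ Vec.map suc (vars n)))))
      (translate φ L R′ D))
    translateStep {n} (I φ) (R′ , D′ , L) R D =
      and (all (atom D x₀ ⇒ᶠ atom D′ x₀))
      (and (all (atom D′ x₀ ⇒ᶠ or (atom D x₀) (atom Y x₀)))
      (and (ex (and (atom D′ x₀) (neg (atom D x₀))))
      (and (∀∈ R′ (freshExtension R D′ D))
      (and (∀ⁿ (suc n) (freshExtension R D′ D ⇒ᶠ atom R′ (vars (suc n))))
      (translate φ L R′ D′)))))
      where
      freshExtension : Ref σ n → Ref σ 1 → Ref σ 1 → FO σ (suc n + 0)
      freshExtension R D′ D = and (atom R (outerVars n)) (and (atom D′ (boundVar n)) (neg (atom D (boundVar n))))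

  vals-vars : ∀ {N n} (v : Vec (Fin N) n) → vals (v ++ []) (vars n) ≡ v
  vals-vars {n = n} v = trans (vals-↑ˡ v [] (allFin n)) (vals-allFin v)

  vals-block₁ : ∀ {N n j} (v w : Vec (Fin N) n) (xs : Vec (Fin n) j) → vals (v ++ (w ++ [])) (block₁ xs) ≡ vals v xs
  vals-block₁ v w xs = vals-↑ˡ v (w ++ []) xs

  vals-block₂ : ∀ {N n j} (v w : Vec (Fin N) n) (xs : Vec (Fin n) j) → vals (v ++ (w ++ [])) (block₂ xs) ≡ vals w xs
  vals-block₂ v w xs = trans (vals-↑ʳ v (w ++ []) _) (vals-↑ˡ w [] xs)

  vals-block₁³ : ∀ {N n j} (u v w : Vec (Fin N) n) (xs : Vec (Fin n) j) →
    vals (u ++ (v ++ (w ++ []))) (block₁³ xs) ≡ vals u xs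
  vals-block₁³ u v w xs = vals-↑ˡ u _ xs

  vals-block₂³ : ∀ {N n j} (u v w : Vec (Fin N) n) (xs : Vec (Fin n) j) →
    vals (u ++ (v ++ (w ++ []))) (block₂³ xs) ≡ vals v xs
  vals-block₂³ u v w xs = trans (vals-↑ʳ u _ (block₁ xs)) (vals-block₁ v w xs)

  vals-block₃³ : ∀ {N n j} (u v w : Vec (Fin N) n) (xs : Vec (Fin n) j) →
    vals (u ++ (v ++ (w ++ []))) (block₃³ xs) ≡ vals w xs
  vals-block₃³ u v w xs = trans (vals-↑ʳ u _ (block₂ xs)) (vals-block₂ v w xs)

  module _ {N} {M : Struct σ N} where
    open FOSatProperties M

    atom-vars⇐ : ∀ {n} (R : Ref σ n) v → T (relOf M R v) → FOSat M (atom R (vars n)) (v ++ [])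
    atom-vars⇐ R v = atom⇐ R (vars _) (v ++ []) (vals-vars v)

    atom-vars⇒ : ∀ {n} (R : Ref σ n) v → FOSat M (atom R (vars n)) (v ++ []) → T (relOf M R v)
    atom-vars⇒ R v = atom⇒ R (vars _) (v ++ []) (vals-vars v)

    atom-outer⇐ : ∀ {n} (R : Ref σ n) c v → T (relOf M R v) → FOSat M (atom R (outerVars n)) ((c ∷ v) ++ [])
    atom-outer⇐ R c v = atom⇐ R (outerVars _) ((c ∷ v) ++ []) (cong tail (vals-vars (c ∷ v)))

    atom-outer⇒ : ∀ {n} (R : Ref σ n) c v → FOSat M (atom R (outerVars n)) ((c ∷ v) ++ []) → T (relOf M R v)
    atom-outer⇒ R c v = atom⇒ R (outerVars _) ((c ∷ v) ++ []) (cong tail (vals-vars (c ∷ v)))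

    atom-bound⇐ : ∀ {n} (D : Ref σ 1) c (v : Vec (Fin N) n) →
      T (relOf M D (c ∷ [])) → FOSat M (atom D (boundVar n)) ((c ∷ v) ++ [])
    atom-bound⇐ D c v = atom⇐ D (boundVar _) ((c ∷ v) ++ []) refl

    atom-bound⇒ : ∀ {n} (D : Ref σ 1) c (v : Vec (Fin N) n) →
      FOSat M (atom D (boundVar n)) ((c ∷ v) ++ []) → T (relOf M D (c ∷ []))
    atom-bound⇒ D c v = atom⇒ D (boundVar _) ((c ∷ v) ++ []) refl

    ∀∈⇒ : ∀ {n} (R : Ref σ n) {φ : FO σ (n + 0)} → FOSat M (∀∈ R φ) [] →
      ∀ v → T (relOf M R v) → FOSat M φ (v ++ [])
    ∀∈⇒ {n} R h v t = modus-ponens (∀ⁿ⇒ n _ h v) (atom-vars⇐ R v t)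

    ∀∈⇐ : ∀ {n} (R : Ref σ n) {φ : FO σ (n + 0)} →
      (∀ v → T (relOf M R v) → FOSat M φ (v ++ [])) → FOSat M (∀∈ R φ) []
    ∀∈⇐ {n} R f = ∀ⁿ⇐ n _ (λ v → implication (atom? R (vars n) {v ++ []}) (λ h → f v (atom-vars⇒ R v h)))

    ∀²⇒ : ∀ {n} {φ : FO σ (n + (n + 0))} → FOSat M (∀ⁿ n (∀ⁿ n φ)) [] → ∀ v w → FOSat M φ (v ++ (w ++ []))
    ∀²⇒ {n} h v w = ∀ⁿ⇒ n _ (∀ⁿ⇒ n _ h w) v

    ∀²⇐ : ∀ {n} {φ : FO σ (n + (n + 0))} → (∀ v w → FOSat M φ (v ++ (w ++ []))) → FOSat M (∀ⁿ n (∀ⁿ n φ)) []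
    ∀²⇐ {n} f = ∀ⁿ⇐ n _ (λ w → ∀ⁿ⇐ n _ (λ v → f v w))

    teamWithin⇒ : ∀ {n} (R : Ref σ n) (D : Ref σ 1) → FOSat M (teamWithin R D) [] →
      ∀ v → T (relOf M R v) → ∀ j → T (relOf M D (lookup v j ∷ []))
    teamWithin⇒ {n} R D h v t j =
      atom⇒ D ((j ↑ˡ 0) ∷ []) (v ++ []) (cong (_∷ []) (Vecₚ.lookup-++ˡ v [] j))
        (⋀⇒ n _ {v ++ []} (∀∈⇒ R h v t) j)

    teamWithin⇐ : ∀ {n} (R : Ref σ n) (D : Ref σ 1) →
      (∀ v → T (relOf M R v) → ∀ j → T (relOf M D (lookup v j ∷ []))) → FOSat M (teamWithin R D) []
    teamWithin⇐ {n} R D f = ∀∈⇐ R (λ v t → ⋀⇐ n _ {v ++ []} (λ j →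
      atom⇐ D ((j ↑ˡ 0) ∷ []) (v ++ []) (cong (_∷ []) (Vecₚ.lookup-++ˡ v [] j)) (f v t j)))

    ≐⇐-via : ∀ {n j} (xs ys : Vec (Fin n) j) (s : Vec (Fin N) n) {a b} →
      vals s xs ≡ a → vals s ys ≡ b → a ≡ b → FOSat M (xs ≐ ys) s
    ≐⇐-via xs ys s refl refl a≡b = ≐⇐ xs ys a≡b

    ≐⇒-via : ∀ {n j} (xs ys : Vec (Fin n) j) (s : Vec (Fin N) n) {a b} →
      vals s xs ≡ a → vals s ys ≡ b → FOSat M (xs ≐ ys) s → a ≡ b
    ≐⇒-via xs ys s refl refl = ≐⇒ xs ys

    atom-block₁⇐ : ∀ {n} (R : Ref σ n) v w → T (relOf M R v) → FOSat M (atom R (block₁ (allFin n))) (v ++ (w ++ []))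
    atom-block₁⇐ R v w = atom⇐ R _ (v ++ (w ++ [])) (trans (vals-block₁ v w _) (vals-allFin v))

    atom-block₂⇐ : ∀ {n} (R : Ref σ n) v w → T (relOf M R w) → FOSat M (atom R (block₂ (allFin n))) (v ++ (w ++ []))
    atom-block₂⇐ R v w = atom⇐ R _ (v ++ (w ++ [])) (trans (vals-block₂ v w _) (vals-allFin w))

    atom-block₁⇒ : ∀ {n} (R : Ref σ n) v w → FOSat M (atom R (block₁ (allFin n))) (v ++ (w ++ [])) → T (relOf M R v)
    atom-block₁⇒ R v w = atom⇒ R _ (v ++ (w ++ [])) (trans (vals-block₁ v w _) (vals-allFin v))

    atom-block₂⇒ : ∀ {n} (R : Ref σ n) v w → FOSat M (atom R (block₂ (allFin n))) (v ++ (w ++ [])) → T (relOf M R w)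
    atom-block₂⇒ R v w = atom⇒ R _ (v ++ (w ++ [])) (trans (vals-block₂ v w _) (vals-allFin w))

    atom-block₁³⇐ : ∀ {n} (R : Ref σ n) u v w → T (relOf M R u) →
      FOSat M (atom R (block₁³ (allFin n))) (u ++ (v ++ (w ++ [])))
    atom-block₁³⇐ R u v w = atom⇐ R _ (u ++ (v ++ (w ++ []))) (trans (vals-block₁³ u v w _) (vals-allFin u))

    atom-block₁³⇒ : ∀ {n} (R : Ref σ n) u v w →
      FOSat M (atom R (block₁³ (allFin n))) (u ++ (v ++ (w ++ []))) → T (relOf M R u)
    atom-block₁³⇒ R u v w = atom⇒ R _ (u ++ (v ++ (w ++ []))) (trans (vals-block₁³ u v w _) (vals-allFin u))

record Enumeration (N : ℕ) (P : Fin N → Bool) (k : ℕ) : Set where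
  field
    elem : Fin k → Fin N
    elem-injective : ∀ i j → elem i ≡ elem j → i ≡ j
    elem-satisfies : ∀ i → T (P (elem i))
    elem-surjective : ∀ y → T (P y) → Σ (Fin k) λ i → elem i ≡ y

enumerate : ∀ N (P : Fin N → Bool) → Σ ℕ (Enumeration N P)
enumerate zero P = 0 , record
  { elem = λ () ; elem-injective = λ () ; elem-satisfies = λ () ; elem-surjective = λ () }
enumerate (suc N) P with enumerate N (λ y → P (suc y)) | P zero in P0
... | k , e | true = suc k , record
  { elem = elem′ ; elem-injective = injective ; elem-satisfies = satisfies ; elem-surjective = surjective }
  where
  open Enumeration e
  elem′ : Fin (suc k) → Fin (suc N)
  elem′ zero = zero
  elem′ (suc i) = suc (elem i)
  injective : ∀ i j → elem′ i ≡ elem′ j → i ≡ j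
  injective zero zero _ = refl
  injective (suc i) (suc j) p = cong suc (elem-injective i j (Finₚ.suc-injective p))
  satisfies : ∀ i → T (P (elem′ i))
  satisfies zero = T-≡ .from P0
  satisfies (suc i) = elem-satisfies i
  surjective : ∀ y → T (P y) → Σ _ λ i → elem′ i ≡ y
  surjective zero _ = zero , refl
  surjective (suc y) t with elem-surjective y t
  ... | i , p = suc i , cong suc p
... | k , e | false = k , record
  { elem = λ i → suc (elem i)
  ; elem-injective = λ i j p → elem-injective i j (Finₚ.suc-injective p)
  ; elem-satisfies = elem-satisfies
  ; elem-surjective = surjective }
  where
  open Enumeration e
  surjective : ∀ y → T (P y) → Σ _ λ i → suc (elem i) ≡ y
  surjective zero t = ⊥-elim (¬T-false P0 t)
  surjective (suc y) t with elem-surjective y t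
  ... | i , p = i , cong suc p

enumerate-nonempty : ∀ {N} (P : Fin N → Bool) y → T (P y) → Σ ℕ λ k → Enumeration N P (suc k)
enumerate-nonempty {N} P y t with enumerate N P
... | zero , e with () ← proj₁ (Enumeration.elem-surjective e y t)
... | suc k , e = k , e

-- A window presents a τ-structure on Fin c as the part of E cut out by the unary D.

module Windows (τ σ : Vocab) (τ-ref : (i : Sym τ) → Ref σ (arity τ i)) {N : ℕ} (E : Struct σ N) where

  record Window {c} (M′ : Struct τ c) (D : Ref σ 1) : Set where
    field
      emb : Fin c → Fin N
      emb-injective : ∀ x y → emb x ≡ emb y → x ≡ y
      interp-emb : ∀ i v → interp M′ i v ≡ relOf E (τ-ref i) (Vec.map emb v)
      emb∈D : ∀ x → T (relOf E D (emb x ∷ []))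
      D⊆emb : ∀ y → T (relOf E D (y ∷ [])) → Σ (Fin c) λ x → emb x ≡ y

  record Codes {c M′ D} (W : Window {c} M′ D) {n} (R : Ref σ n) (U : Team c n) : Set where
    open Window W
    field
      encode : ∀ s → T (U s) → T (relOf E R (Vec.map emb s))
      decode : ∀ s → T (relOf E R (Vec.map emb s)) → T (U s)

  record Exact {c M′ D} (W : Window {c} M′ D) {n} (R : Ref σ n) (U : Team c n) : Set where
    open Window W
    field
      codes : Codes W R U
      R⊆emb : ∀ v → T (relOf E R v) → Σ (Vec (Fin c) n) λ s → Vec.map emb s ≡ v
    open Codes codes public

  module WindowProperties {c} {M′ : Struct τ c} {D : Ref σ 1} (W : Window M′ D) where
    open Window W

    lookup-emb : ∀ {n} (s : Vec (Fin c) n) x → lookup (Vec.map emb s ++ []) (x ↑ˡ 0) ≡ emb (lookup s x)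
    lookup-emb s x = trans (Vecₚ.lookup-++ˡ (Vec.map emb s) [] x) (Vecₚ.lookup-map x emb s)

    vals-emb-↑ˡ : ∀ {n j} (s : Vec (Fin c) n) (xs : Vec (Fin n) j) →
      vals (Vec.map emb s ++ []) (Vec.map (_↑ˡ 0) xs) ≡ Vec.map emb (vals s xs)
    vals-emb-↑ˡ s xs = trans (vals-↑ˡ (Vec.map emb s) [] xs) (vals-map emb s xs)

    vals-emb : ∀ {n j} (s t : Vec (Fin c) n) (xs zs : Vec (Fin n) j) →
      vals s xs ≡ vals t zs → vals (Vec.map emb s) xs ≡ vals (Vec.map emb t) zs
    vals-emb s t xs zs p = trans (vals-map emb s xs) (trans (cong (Vec.map emb) p) (sym (vals-map emb t zs)))

    vals-emb⁻¹ : ∀ {n j} (s t : Vec (Fin c) n) (xs zs : Vec (Fin n) j) →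
      vals (Vec.map emb s) xs ≡ vals (Vec.map emb t) zs → vals s xs ≡ vals t zs
    vals-emb⁻¹ s t xs zs p =
      map-injective emb emb-injective _ _ (trans (sym (vals-map emb s xs)) (trans p (vals-map emb t zs)))

    lookup-emb²ˡ : ∀ {n} (s t : Vec (Fin c) n) y →
      lookup (Vec.map emb s ++ (Vec.map emb t ++ [])) (y ↑ˡ (n + 0)) ≡ emb (lookup s y)
    lookup-emb²ˡ s t y = trans (Vecₚ.lookup-++ˡ (Vec.map emb s) _ y) (Vecₚ.lookup-map y emb s)

    lookup-emb²ʳ : ∀ {n} (s t : Vec (Fin c) n) y →
      lookup (Vec.map emb s ++ (Vec.map emb t ++ [])) (n ↑ʳ (y ↑ˡ 0)) ≡ emb (lookup t y)
    lookup-emb²ʳ s t y = trans (Vecₚ.lookup-++ʳ (Vec.map emb s) _ (y ↑ˡ 0)) (lookup-emb t y)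

    D-preimage : ∀ {n} (v : Vec (Fin N) n) → (∀ j → T (relOf E D (lookup v j ∷ []))) →
      Σ (Vec (Fin c) n) λ s → Vec.map emb s ≡ v
    D-preimage v v⊆D = map-preimage emb v (λ j → D⊆emb _ (v⊆D j))

  interp-+S-via : ∀ {c k} {M′ : Struct τ c} (e : Fin c → Fin N) (e′ : Fin (c + k) → Fin N) →
    (∀ i v → interp M′ i v ≡ relOf E (τ-ref i) (Vec.map e v)) →
    (∀ x → e′ (x ↑ˡ k) ≡ e x) →
    (∀ i (v : Vec (Fin N) (arity τ i)) l j → lookup v l ≡ e′ (c ↑ʳ j) → relOf E (τ-ref i) v ≡ false) →
    ∀ i v → interp (M′ +S k) i v ≡ relOf E (τ-ref i) (Vec.map e′ v)
  interp-+S-via {c} {k} {M′} e e′ interp-e e′-↑ˡ τ-avoids-new i v rewrite interp-+S M′ k i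
    with restrictV {c} {k} v in r≡
  ... | just w rewrite restrictV≡just v r≡ = trans (interp-e i w) (cong (relOf E (τ-ref i))
        (trans (Vecₚ.map-cong (λ x → sym (e′-↑ˡ x)) w) (Vecₚ.map-∘ e′ (_↑ˡ k) w)))
  ... | nothing with restrictV≡nothing v r≡
  ... | l , j , p = sym (τ-avoids-new i (Vec.map e′ v) l j (trans (Vecₚ.lookup-map l e′ v) (cong e′ p)))

  module Extension {c k} {M′ : Struct τ c} {D : Ref σ 1} (W : Window M′ D) (D′ : Ref σ 1) (g : Fin k → Fin N)
    (g-injective : ∀ i j → g i ≡ g j → i ≡ j)
    (g∉D : ∀ j → ¬ T (relOf E D (g j ∷ [])))
    (D⊆D′ : ∀ y → T (relOf E D (y ∷ [])) → T (relOf E D′ (y ∷ [])))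
    (g∈D′ : ∀ j → T (relOf E D′ (g j ∷ [])))
    (D′⊆D∪g : ∀ y → T (relOf E D′ (y ∷ [])) → ¬ T (relOf E D (y ∷ [])) → Σ (Fin k) λ j → g j ≡ y)
    (τ-avoids-g : ∀ i (v : Vec (Fin N) (arity τ i)) l j → lookup v l ≡ g j → relOf E (τ-ref i) v ≡ false)
    where
    open Window W

    extendedEmb : Fin (c + k) → Fin N
    extendedEmb = emb Vector.++ g

    extendedEmb-↑ˡ : ∀ x → extendedEmb (x ↑ˡ k) ≡ emb x
    extendedEmb-↑ˡ = Vectorₚ.lookup-++ˡ emb g

    extendedEmb-↑ʳ : ∀ j → extendedEmb (c ↑ʳ j) ≡ g j
    extendedEmb-↑ʳ = Vectorₚ.lookup-++ʳ emb g

    map-extendedEmb-↑ˡ : ∀ {n} (s : Vec (Fin c) n) → Vec.map extendedEmb (Vec.map (_↑ˡ k) s) ≡ Vec.map emb s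
    map-extendedEmb-↑ˡ s = trans (sym (Vecₚ.map-∘ extendedEmb (_↑ˡ k) s)) (Vecₚ.map-cong extendedEmb-↑ˡ s)

    extendedEmb∈D⇒old : ∀ z → T (relOf E D (extendedEmb z ∷ [])) → Σ (Fin c) λ x → x ↑ˡ k ≡ z
    extendedEmb∈D⇒old z d with oldOrNew c k z
    ... | old x = x , refl
    ... | new j = ⊥-elim (g∉D j (subst (λ y → T (relOf E D (y ∷ []))) (extendedEmb-↑ʳ j) d))

    extendedEmb∉D⇒new : ∀ z → ¬ T (relOf E D (extendedEmb z ∷ [])) → T (isNew {c} {k} z)
    extendedEmb∉D⇒new z ¬d with oldOrNew c k z
    ... | old x = ⊥-elim (¬d (subst (λ y → T (relOf E D (y ∷ []))) (sym (extendedEmb-↑ˡ x)) (emb∈D x)))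
    ... | new j = isNew-↑ʳ j

    private
      injective : ∀ z z′ → extendedEmb z ≡ extendedEmb z′ → z ≡ z′
      injective z z′ p with oldOrNew c k z | oldOrNew c k z′
      ... | old x | old x′ = cong (_↑ˡ k) (emb-injective x x′
            (trans (sym (extendedEmb-↑ˡ x)) (trans p (extendedEmb-↑ˡ x′))))
      ... | old x | new j = ⊥-elim (g∉D j (subst (λ y → T (relOf E D (y ∷ [])))
            (trans (sym (extendedEmb-↑ˡ x)) (trans p (extendedEmb-↑ʳ j))) (emb∈D x)))
      ... | new j | old x = ⊥-elim (g∉D j (subst (λ y → T (relOf E D (y ∷ [])))
            (trans (sym (extendedEmb-↑ˡ x)) (trans (sym p) (extendedEmb-↑ʳ j))) (emb∈D x)))
      ... | new j | new j′ = cong (c ↑ʳ_) (g-injective j j′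
            (trans (sym (extendedEmb-↑ʳ j)) (trans p (extendedEmb-↑ʳ j′))))

      extendedEmb∈D′ : ∀ z → T (relOf E D′ (extendedEmb z ∷ []))
      extendedEmb∈D′ z with oldOrNew c k z
      ... | old x = subst (λ y → T (relOf E D′ (y ∷ []))) (sym (extendedEmb-↑ˡ x)) (D⊆D′ _ (emb∈D x))
      ... | new j = subst (λ y → T (relOf E D′ (y ∷ []))) (sym (extendedEmb-↑ʳ j)) (g∈D′ j)

      D′⊆extendedEmb : ∀ y → T (relOf E D′ (y ∷ [])) → Σ (Fin (c + k)) λ z → extendedEmb z ≡ y
      D′⊆extendedEmb y d′ with T? (relOf E D (y ∷ []))
      ... | yes d = proj₁ (D⊆emb y d) ↑ˡ k , trans (extendedEmb-↑ˡ _) (proj₂ (D⊆emb y d))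
      ... | no ¬d = c ↑ʳ proj₁ (D′⊆D∪g y d′ ¬d) , trans (extendedEmb-↑ʳ _) (proj₂ (D′⊆D∪g y d′ ¬d))

    extend : Window (M′ +S k) D′
    extend = record
      { emb = extendedEmb ; emb-injective = injective
      ; interp-emb = interp-+S-via emb extendedEmb interp-emb extendedEmb-↑ˡ
          (λ i v l j p → τ-avoids-g i v l j (trans p (extendedEmb-↑ʳ j)))
      ; emb∈D = extendedEmb∈D′ ; D⊆emb = D′⊆extendedEmb }

-- Soundness

module Soundness (τ σ : Vocab) (τ-ref : (i : Sym τ) → Ref σ (arity τ i)) (Y : Ref σ 1)
  {N : ℕ} (E : Struct σ N) where
  open AuxiliaryRelations τ
  open Translation τ σ τ-ref Y
  open Windows τ σ τ-ref E
  open FOSatProperties E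

  module AtomicCases {c} {M′ : Struct τ c} {D : Ref σ 1} (W : Window M′ D)
    {n} {R : Ref σ n} {U : Team c n} (codes : Codes W R U) (within : FOSat E (teamWithin R D) []) where
    open Window W
    open WindowProperties W
    open Codes codes

    decode-R : ∀ v → T (relOf E R v) → Σ (Vec (Fin c) n) λ s → Vec.map emb s ≡ v × T (U s)
    decode-R v t with D-preimage v (teamWithin⇒ R D within v t)
    ... | s , refl = s , refl , decode s t

    R-pair : ∀ s t → T (U s) → T (U t) → let env = Vec.map emb s ++ (Vec.map emb t ++ []) in
      FOSat E (atom R (block₁ (allFin n))) env × FOSat E (atom R (block₂ (allFin n))) env
    R-pair s t s∈U t∈U =
      atom-block₁⇐ R (Vec.map emb s) (Vec.map emb t) (encode s s∈U) , atom-block₂⇐ R (Vec.map emb s) _ (encode t t∈U)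

    ≐-pair : ∀ {j} s t (xs zs : Vec (Fin n) j) → vals s xs ≡ vals t zs →
      FOSat E (block₁ xs ≐ block₂ zs) (Vec.map emb s ++ (Vec.map emb t ++ []))
    ≐-pair s t xs zs p = ≐⇐-via (block₁ xs) (block₂ zs) (Vec.map emb s ++ (Vec.map emb t ++ []))
      (vals-block₁ (Vec.map emb s) _ xs) (vals-block₂ (Vec.map emb s) (Vec.map emb t) zs) (vals-emb s t xs zs p)

    sound-rel : ∀ i xs → FOSat E (translateStep (rel i xs) tt R D) [] → DSat M′ (rel i xs) U
    sound-rel i xs h s s∈U = subst T (sym (interp-emb i _))
      (atom⇒ (τ-ref i) _ (Vec.map emb s ++ []) (vals-emb-↑ˡ s xs) (∀∈⇒ R h (Vec.map emb s) (encode s s∈U)))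

    sound-nrel : ∀ i xs → FOSat E (translateStep (nrel i xs) tt R D) [] → DSat M′ (nrel i xs) U
    sound-nrel i xs h s s∈U t = ∀∈⇒ R h (Vec.map emb s) (encode s s∈U)
      (atom⇐ (τ-ref i) _ (Vec.map emb s ++ []) (vals-emb-↑ˡ s xs) (subst T (interp-emb i _) t))

    sound-eq : ∀ x y → FOSat E (translateStep (eq x y) tt R D) [] → DSat M′ (eq x y) U
    sound-eq x y h s s∈U = emb-injective _ _
      (trans (sym (lookup-emb s x)) (trans (∀∈⇒ R h (Vec.map emb s) (encode s s∈U)) (lookup-emb s y)))

    sound-neq : ∀ x y → FOSat E (translateStep (neq x y) tt R D) [] → DSat M′ (neq x y) U
    sound-neq x y h s s∈U p = ∀∈⇒ R h (Vec.map emb s) (encode s s∈U)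
      (trans (lookup-emb s x) (trans (cong emb p) (sym (lookup-emb s y))))

    sound-dep : ∀ {j} (xs : Vec (Fin n) j) y → FOSat E (translateStep (dep xs y) tt R D) [] → DSat M′ (dep xs y) U
    sound-dep xs y h s t s∈U t∈U xs≡ = emb-injective _ _ (begin
      emb (lookup s y)                ≡⟨ lookup-emb²ˡ s t y ⟨
      lookup env (y ↑ˡ (n + 0))       ≡⟨ modus-ponens (∀²⇒ h v w) (s∈R , t∈R , ≐-pair s t xs xs xs≡) ⟩
      lookup env (n ↑ʳ (y ↑ˡ 0))      ≡⟨ lookup-emb²ʳ s t y ⟩
      emb (lookup t y)                ∎)
      where
      open ≡-Reasoning
      v = Vec.map emb s
      w = Vec.map emb t
      env = v ++ (w ++ [])
      s∈R = proj₁ (R-pair s t s∈U t∈U)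
      t∈R = proj₂ (R-pair s t s∈U t∈U)

    sound-inc : ∀ {j} (xs zs : Vec (Fin n) j) → FOSat E (translateStep (inc xs zs) tt R D) [] → DSat M′ (inc xs zs) U
    sound-inc xs zs h s s∈U with ∃ⁿ⇒ n _ (∀∈⇒ R h (Vec.map emb s) (encode s s∈U))
    ... | w , w∈R , xs≐zs with decode-R w (atom-block₁⇒ R w (Vec.map emb s) w∈R)
    ... | t , refl , t∈U = t , t∈U , vals-emb⁻¹ s t xs zs
          (≐⇒-via (block₂ xs) (block₁ zs) (w ++ (Vec.map emb s ++ [])) (vals-block₂ w _ xs) (vals-block₁ w _ zs) xs≐zs)

    sound-exc : ∀ {j} (xs zs : Vec (Fin n) j) → FOSat E (translateStep (exc xs zs) tt R D) [] → DSat M′ (exc xs zs) U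
    sound-exc xs zs h s t s∈U t∈U p =
      modus-ponens (∀²⇒ h (Vec.map emb s) (Vec.map emb t)) (R-pair s t s∈U t∈U) (≐-pair s t xs zs p)

    sound-ind : ∀ {a b d} (xs : Vec (Fin n) a) (zs : Vec (Fin n) b) (ws : Vec (Fin n) d) →
      FOSat E (translateStep (ind xs zs ws) tt R D) [] → DSat M′ (ind xs zs ws) U
    sound-ind xs zs ws h s s′ s∈U s′∈U zs≡ with ∃ⁿ⇒ n _
      (modus-ponens (∀²⇒ h v w)
        (proj₁ (R-pair s s′ s∈U s′∈U) , proj₂ (R-pair s s′ s∈U s′∈U) , ≐-pair s s′ zs zs zs≡))
      where
      v = Vec.map emb s
      w = Vec.map emb s′
    ... | u , u∈R , xs≐ , zs≐ , ws≐ with decode-R u (atom-block₁³⇒ R u (Vec.map emb s) (Vec.map emb s′) u∈R)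
    ... | t , refl , t∈U = t , t∈U ,
          vals-emb⁻¹ t s xs xs (≐⇒-via (block₁³ xs) (block₂³ xs) env (vals-block₁³ u v w xs) (vals-block₂³ u v w xs) xs≐) ,
          vals-emb⁻¹ t s zs zs (≐⇒-via (block₁³ zs) (block₂³ zs) env (vals-block₁³ u v w zs) (vals-block₂³ u v w zs) zs≐) ,
          vals-emb⁻¹ t s′ ws ws (≐⇒-via (block₁³ ws) (block₃³ ws) env (vals-block₁³ u v w ws) (vals-block₃³ u v w ws) ws≐)
      where
      v = Vec.map emb s
      w = Vec.map emb s′
      env = u ++ (v ++ (w ++ []))



  module ConnectiveCases {c} {M′ : Struct τ c} {D : Ref σ 1} (W : Window M′ D)
    {n} {R : Ref σ n} {U : Team c n} (codes : Codes W R U) where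
    open Window W
    open Codes codes

    sound-or : (φ ψ : DStar τ n) (R₀ R₁ : Ref σ n) (L₁ : Slots (Ref σ) φ) (L₂ : Slots (Ref σ) ψ) →
      (FOSat E (translate φ L₁ R₀ D) [] → (U₀ : Team c n) → Codes W R₀ U₀ → DSat M′ φ U₀) →
      (FOSat E (translate ψ L₂ R₁ D) [] → (U₁ : Team c n) → Codes W R₁ U₁ → DSat M′ ψ U₁) →
      FOSat E (translateStep (or φ ψ) (R₀ , R₁ , L₁ , L₂) R D) [] → DSat M′ (or φ ψ) U
    sound-or φ ψ R₀ R₁ L₁ L₂ IH₀ IH₁ (R⊆R₀∪R₁ , R₀⊆R , R₁⊆R , h₀ , h₁) =
      U₀ , U₁ , cover , U₀⊆U , U₁⊆U ,
      IH₀ h₀ U₀ (record { encode = λ _ t → t ; decode = λ _ t → t }) ,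
      IH₁ h₁ U₁ (record { encode = λ _ t → t ; decode = λ _ t → t })
      where
      U₀ U₁ : Team c n
      U₀ s = relOf E R₀ (Vec.map emb s)
      U₁ s = relOf E R₁ (Vec.map emb s)
      cover : ∀ s → T (U s) → T (U₀ s) ⊎ T (U₁ s)
      cover s s∈U with ∀∈⇒ R R⊆R₀∪R₁ (Vec.map emb s) (encode s s∈U)
      ... | inj₁ h = inj₁ (atom-vars⇒ R₀ _ h)
      ... | inj₂ h = inj₂ (atom-vars⇒ R₁ _ h)
      U₀⊆U : ∀ s → T (U₀ s) → T (U s)
      U₀⊆U s t = decode s (atom-vars⇒ R _ (∀∈⇒ R₀ R₀⊆R (Vec.map emb s) t))
      U₁⊆U : ∀ s → T (U₁ s) → T (U s)
      U₁⊆U s t = decode s (atom-vars⇒ R _ (∀∈⇒ R₁ R₁⊆R (Vec.map emb s) t))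

    sound-all : (φ : DStar τ (suc n)) (R′ : Ref σ (suc n)) (L : Slots (Ref σ) φ) →
      (FOSat E (translate φ L R′ D) [] → (U′ : Team c (suc n)) → Codes W R′ U′ → DSat M′ φ U′) →
      FOSat E (translateStep (all φ) (R′ , L) R D) [] → DSat M′ (all φ) U
    sound-all φ R′ L IH (R′⇒ , ⇒R′ , hφ) = IH hφ (λ t → U (tail t)) (record { encode = enc ; decode = dec })
      where
      enc : ∀ t → T (U (tail t)) → T (relOf E R′ (Vec.map emb t))
      enc (x ∷ s) s∈U = atom-vars⇒ R′ _ (modus-ponens (∀ⁿ⇒ (suc n) _ ⇒R′ (emb x ∷ Vec.map emb s))
        (atom-outer⇐ R _ _ (encode s s∈U) , atom-bound⇐ D _ _ (emb∈D x)))
      dec : ∀ t → T (relOf E R′ (Vec.map emb t)) → T (U (tail t))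
      dec (x ∷ s) t = decode s (atom-outer⇒ R _ _ (proj₁ (∀∈⇒ R′ R′⇒ (emb x ∷ Vec.map emb s) t)))

    sound-ex : (φ : DStar τ (suc n)) (R′ : Ref σ (suc n)) (L : Slots (Ref σ) φ) →
      (FOSat E (translate φ L R′ D) [] → (U′ : Team c (suc n)) → Codes W R′ U′ → DSat M′ φ U′) →
      FOSat E (translateStep (ex φ) (R′ , L) R D) [] → DSat M′ (ex φ) U
    sound-ex φ R′ L IH (R′⇒ , R⇒∃ , hφ) = f , nonempty , IH hφ U′ (record { encode = enc ; decode = dec })
      where
      f : Vec (Fin c) n → Fin c → Bool
      f s x = relOf E R′ (emb x ∷ Vec.map emb s)
      U′ : Team c (suc n)
      U′ t = U (tail t) ∧ f (tail t) (head t)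
      witness∈R′ : ∀ s y → FOSat E (atom R′ (zero ∷ Vec.map suc (vars n))) (y ∷ (Vec.map emb s ++ [])) →
        T (relOf E R′ (y ∷ Vec.map emb s))
      witness∈R′ s y = atom⇒ R′ _ (y ∷ (Vec.map emb s ++ [])) (cong (y ∷_) (trans (vals-suc y _ (vars n)) (vals-vars _)))
      nonempty : ∀ s → T (U s) → Σ (Fin c) λ x → T (f s x)
      nonempty s s∈U with ∀∈⇒ R R⇒∃ (Vec.map emb s) (encode s s∈U)
      ... | y , hy with D⊆emb y (teamWithin⇒ R′ D (proj₁ hφ) (y ∷ Vec.map emb s) (witness∈R′ s y hy) zero)
      ... | x , refl = x , witness∈R′ s (emb x) hy
      enc : ∀ t → T (U′ t) → T (relOf E R′ (Vec.map emb t))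
      enc (x ∷ s) t = T-∧-snd {U s} t
      dec : ∀ t → T (relOf E R′ (Vec.map emb t)) → T (U′ t)
      dec (x ∷ s) t = T-∧-intro (decode s (atom-outer⇒ R _ _ (∀∈⇒ R′ R′⇒ (emb x ∷ Vec.map emb s) t))) t

  module _ (τ-avoids-Y : ∀ i (v : Vec (Fin N) (arity τ i)) l →
             T (relOf E Y (lookup v l ∷ [])) → relOf E (τ-ref i) v ≡ false) where

    -- The fresh elements of I are read off from D′ ∖ D, which is nonempty and
    -- (as D′ ⊆ D ∪ Y) avoids every τ-relation.
    sound-I : ∀ {c} {M′ : Struct τ c} {D} (W : Window M′ D) {n} {R : Ref σ n} {U : Team c n} →
      Codes W R U → FOSat E (teamWithin R D) [] →
      (φ : DStar τ (suc n)) (R′ : Ref σ (suc n)) (D′ : Ref σ 1) (L : Slots (Ref σ) φ) →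
      (FOSat E (translate φ L R′ D′) [] →
        ∀ {c′} {M″ : Struct τ c′} (W′ : Window M″ D′) (U′ : Team c′ (suc n)) → Codes W′ R′ U′ → DSat M″ φ U′) →
      FOSat E (translateStep (I φ) (R′ , D′ , L) R D) [] → DSat M′ (I φ) U
    sound-I {c} {M′} {D} W {n} {R} {U} codes within φ R′ D′ L IH (D⊆D′ , D′⊆D∪Y , fresh , R′⇒ , ⇒R′ , hφ) =
      withFresh (enumerate-nonempty P y₀ P-y₀)
      where
      open Window W
      open Codes codes
      In : Ref σ 1 → Fin N → Set
      In X y = T (relOf E X (y ∷ []))
      P : Fin N → Bool
      P y = relOf E D′ (y ∷ []) ∧ not (relOf E D (y ∷ []))
      y₀ = proj₁ fresh
      P-y₀ : T (P y₀)
      P-y₀ = T-∧-intro (atom⇒ D′ x₀ (y₀ ∷ []) refl (proj₁ (proj₂ fresh)))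
                       (¬T⇒T-not (λ d → proj₂ (proj₂ fresh) (atom⇐ D x₀ (y₀ ∷ []) refl d)))
      D⊆D′′ : ∀ y → In D y → In D′ y
      D⊆D′′ y d = atom⇒ D′ x₀ (y ∷ []) refl (modus-ponens (D⊆D′ y) (atom⇐ D x₀ (y ∷ []) refl d))
      D′∖D⊆Y : ∀ y → In D′ y → ¬ In D y → In Y y
      D′∖D⊆Y y d′ ¬d with modus-ponens (D′⊆D∪Y y) (atom⇐ D′ x₀ (y ∷ []) refl d′)
      ... | inj₁ d = ⊥-elim (¬d (atom⇒ D x₀ (y ∷ []) refl d))
      ... | inj₂ y∈Y = atom⇒ Y x₀ (y ∷ []) refl y∈Y

      withFresh : Σ ℕ (λ k → Enumeration N P (suc k)) → DSat M′ (I φ) U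
      withFresh (k , enum) = k , IH hφ extend (liftTeamS {c} {suc k} U) (record { encode = enc ; decode = dec })
        where
        open Enumeration enum
        g∈D′ : ∀ j → In D′ (elem j)
        g∈D′ j = T-∧-fst (elem-satisfies j)
        g∉D : ∀ j → ¬ In D (elem j)
        g∉D j = T-not⇒¬T (T-∧-snd {relOf E D′ (elem j ∷ [])} (elem-satisfies j))
        D′⊆D∪g : ∀ y → In D′ y → ¬ In D y → Σ (Fin (suc k)) λ j → elem j ≡ y
        D′⊆D∪g y d′ ¬d = elem-surjective y (T-∧-intro d′ (¬T⇒T-not ¬d))
        τ-avoids-g : ∀ i (v : Vec (Fin N) (arity τ i)) l j → lookup v l ≡ elem j → relOf E (τ-ref i) v ≡ false
        τ-avoids-g i v l j p = τ-avoids-Y i v l (subst (In Y) (sym p) (D′∖D⊆Y _ (g∈D′ j) (g∉D j)))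
        open Extension W D′ elem elem-injective g∉D D⊆D′′ g∈D′ D′⊆D∪g τ-avoids-g

        enc : ∀ t → T (liftTeamS {c} {suc k} U t) → T (relOf E R′ (Vec.map extendedEmb t))
        enc (z ∷ s) z∷s∈U′ with liftTeamS⇒ U z s z∷s∈U′
        ... | s₀ , refl , z-new , s₀∈U with isNew⇒new z z-new
        ... | j , refl = atom-vars⇒ R′ w (modus-ponens (∀ⁿ⇒ (suc n) _ ⇒R′ w)
              ( atom-outer⇐ R _ _ (subst (λ v → T (relOf E R v)) (sym (map-extendedEmb-↑ˡ s₀)) (encode s₀ s₀∈U))
              , atom-bound⇐ D′ _ _ (subst (In D′) (sym (extendedEmb-↑ʳ j)) (g∈D′ j))
              , λ d → g∉D j (subst (In D) (extendedEmb-↑ʳ j) (atom-bound⇒ D _ _ d))))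
          where w = extendedEmb (c ↑ʳ j) ∷ Vec.map extendedEmb (Vec.map (_↑ˡ suc k) s₀)

        dec : ∀ t → T (relOf E R′ (Vec.map extendedEmb t)) → T (liftTeamS {c} {suc k} U t)
        dec (z ∷ s) t = subst (λ s′ → T (liftTeamS {c} {suc k} U (z ∷ s′))) s₀↑≡s
          (liftTeamS⇐ U z s₀ (extendedEmb∉D⇒new z z∉D) s₀∈U)
          where
          w = extendedEmb z ∷ Vec.map extendedEmb s
          fresh-ext = ∀∈⇒ R′ R′⇒ w t
          s∈R : T (relOf E R (Vec.map extendedEmb s))
          s∈R = atom-outer⇒ R _ _ (proj₁ fresh-ext)
          z∉D : ¬ In D (extendedEmb z)
          z∉D d = proj₂ (proj₂ fresh-ext) (atom-bound⇐ D _ _ d)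
          old-s = map-preimage (_↑ˡ suc k) s (λ l → extendedEmb∈D⇒old (lookup s l)
            (subst (In D) (Vecₚ.lookup-map l extendedEmb s) (teamWithin⇒ R D within _ s∈R l)))
          s₀ = proj₁ old-s
          s₀↑≡s = proj₂ old-s
          s₀∈U : T (U s₀)
          s₀∈U = decode s₀ (subst (λ v → T (relOf E R v))
            (trans (cong (Vec.map extendedEmb) (sym s₀↑≡s)) (map-extendedEmb-↑ˡ s₀)) s∈R)

    sound : ∀ {n} (φ : DStar τ n) (L : Slots (Ref σ) φ) (R : Ref σ n) (D : Ref σ 1)
      {c} {M′ : Struct τ c} (W : Window M′ D) (U : Team c n) → Codes W R U →
      FOSat E (translate φ L R D) [] → DSat M′ φ U
    sound (rel i xs) _ R D W U codes (within , h) = AtomicCases.sound-rel W codes within i xs h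
    sound (nrel i xs) _ R D W U codes (within , h) = AtomicCases.sound-nrel W codes within i xs h
    sound (eq x y) _ R D W U codes (within , h) = AtomicCases.sound-eq W codes within x y h
    sound (neq x y) _ R D W U codes (within , h) = AtomicCases.sound-neq W codes within x y h
    sound (dep xs y) _ R D W U codes (within , h) = AtomicCases.sound-dep W codes within xs y h
    sound (inc xs zs) _ R D W U codes (within , h) = AtomicCases.sound-inc W codes within xs zs h
    sound (exc xs zs) _ R D W U codes (within , h) = AtomicCases.sound-exc W codes within xs zs h
    sound (ind xs zs ws) _ R D W U codes (within , h) = AtomicCases.sound-ind W codes within xs zs ws h
    sound (and φ ψ) (L₁ , L₂) R D W U codes (_ , h₁ , h₂) =
      sound φ L₁ R D W U codes h₁ , sound ψ L₂ R D W U codes h₂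
    sound (or φ ψ) (R₀ , R₁ , L₁ , L₂) R D W U codes (_ , h) = ConnectiveCases.sound-or W codes φ ψ R₀ R₁ L₁ L₂
      (λ h₁ U₀ codes₀ → sound φ L₁ R₀ D W U₀ codes₀ h₁)
      (λ h₂ U₁ codes₁ → sound ψ L₂ R₁ D W U₁ codes₁ h₂) h
    sound (all φ) (R′ , L) R D W U codes (_ , h) =
      ConnectiveCases.sound-all W codes φ R′ L (λ hφ U′ codes′ → sound φ L R′ D W U′ codes′ hφ) h
    sound (ex φ) (R′ , L) R D W U codes (_ , h) =
      ConnectiveCases.sound-ex W codes φ R′ L (λ hφ U′ codes′ → sound φ L R′ D W U′ codes′ hφ) h
    sound (I φ) (R′ , D′ , L) R D W U codes (within , h) =
      sound-I W codes within φ R′ D′ L (λ hφ W′ U′ codes′ → sound φ L R′ D′ W′ U′ codes′ hφ) h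

-- Teams over Fin c, coded as relations on a larger Fin N through the prefix embedding.

module PrefixCoding (N : ℕ) where

  prefix : ∀ {c} → .(c ≤ N) → Fin c → Fin N
  prefix c≤N x = inject≤ x c≤N

  toℕ-prefix : ∀ {c} .(c≤N : c ≤ N) x → toℕ (prefix c≤N x) ≡ toℕ x
  toℕ-prefix c≤N x = Finₚ.toℕ-inject≤ x c≤N

  prefix-injective : ∀ {c} .(c≤N : c ≤ N) x y → prefix c≤N x ≡ prefix c≤N y → x ≡ y
  prefix-injective c≤N = Finₚ.inject≤-injective c≤N c≤N

  prefix-fromℕ< : ∀ {c} .(c≤N : c ≤ N) (y : Fin N) (y<c : toℕ y < c) → prefix c≤N (fromℕ< y<c) ≡ y
  prefix-fromℕ< c≤N y y<c = Finₚ.toℕ-injective (trans (toℕ-prefix c≤N _) (Finₚ.toℕ-fromℕ< y<c))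

  unprefix : ∀ c → Fin N → Maybe (Fin c)
  unprefix c y with toℕ y ℕₚ.<? c
  ... | yes y<c = just (fromℕ< y<c)
  ... | no _ = nothing

  unprefixV : ∀ c {n} → Vec (Fin N) n → Maybe (Vec (Fin c) n)
  unprefixV c [] = just []
  unprefixV c (y ∷ v) with unprefix c y | unprefixV c v
  ... | just x | just xs = just (x ∷ xs)
  ... | _ | _ = nothing

  unprefix-prefix : ∀ {c} .(c≤N : c ≤ N) x → unprefix c (prefix c≤N x) ≡ just x
  unprefix-prefix {c} c≤N x with toℕ (prefix c≤N x) ℕₚ.<? c
  ... | yes p = cong just (prefix-injective c≤N _ _ (prefix-fromℕ< c≤N _ p))
  ... | no ¬p = ⊥-elim (¬p (subst (_< c) (sym (toℕ-prefix c≤N x)) (Finₚ.toℕ<n x)))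

  unprefix≡just : ∀ {c} .(c≤N : c ≤ N) y {x} → unprefix c y ≡ just x → prefix c≤N x ≡ y
  unprefix≡just {c} c≤N y p with toℕ y ℕₚ.<? c
  unprefix≡just {c} c≤N y refl | yes y<c = prefix-fromℕ< c≤N y y<c

  unprefixV-prefix : ∀ {c n} .(c≤N : c ≤ N) (s : Vec (Fin c) n) → unprefixV c (Vec.map (prefix c≤N) s) ≡ just s
  unprefixV-prefix c≤N [] = refl
  unprefixV-prefix c≤N (x ∷ s) rewrite unprefix-prefix c≤N x | unprefixV-prefix c≤N s = refl

  unprefixV≡just : ∀ {c n} .(c≤N : c ≤ N) (v : Vec (Fin N) n) {s} → unprefixV c v ≡ just s →
    Vec.map (prefix c≤N) s ≡ v
  unprefixV≡just c≤N [] refl = refl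
  unprefixV≡just {c} c≤N (y ∷ v) p with unprefix c y in y≡ | unprefixV c v in v≡
  unprefixV≡just {c} c≤N (y ∷ v) refl | just x | just xs =
    cong₂ _∷_ (unprefix≡just c≤N y y≡) (unprefixV≡just c≤N v v≡)

  codeTeam : ∀ c {n} → Team c n → Rel N n
  codeTeam c U v with unprefixV c v
  ... | just s = U s
  ... | nothing = false

  codeTeam⇒ : ∀ {c n} .(c≤N : c ≤ N) (U : Team c n) v → T (codeTeam c U v) →
    Σ (Vec (Fin c) n) λ s → Vec.map (prefix c≤N) s ≡ v × T (U s)
  codeTeam⇒ {c} c≤N U v t with unprefixV c v in v≡
  ... | just s = s , unprefixV≡just c≤N v v≡ , t

  codeTeam⇐ : ∀ {c n} .(c≤N : c ≤ N) (U : Team c n) s → T (U s) → T (codeTeam c U (Vec.map (prefix c≤N) s))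
  codeTeam⇐ c≤N U s t rewrite unprefixV-prefix c≤N s = t

  codeDomain : ℕ → Rel N 1
  codeDomain c (y ∷ []) = toℕ y <ᵇ c

module Witnesses (τ : Vocab) where
  open AuxiliaryRelations τ

  -- An upper bound on the fresh elements introduced by the I's of a derivation,
  -- so that all of them fit into one domain.
  freshNeeded : ∀ {n} (φ : DStar τ n) {c} {M′ : Struct τ c} {U : Team c n} → DSat M′ φ U → ℕ
  freshNeeded (rel i xs) _ = 0
  freshNeeded (nrel i xs) _ = 0
  freshNeeded (eq x y) _ = 0
  freshNeeded (neq x y) _ = 0
  freshNeeded (dep xs y) _ = 0
  freshNeeded (inc xs zs) _ = 0
  freshNeeded (exc xs zs) _ = 0
  freshNeeded (ind xs zs ws) _ = 0
  freshNeeded (and φ ψ) (p , q) = freshNeeded φ p ⊔ freshNeeded ψ q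
  freshNeeded (or φ ψ) (_ , _ , _ , _ , _ , p , q) = freshNeeded φ p ⊔ freshNeeded ψ q
  freshNeeded (all φ) p = freshNeeded φ p
  freshNeeded (ex φ) (_ , _ , p) = freshNeeded φ p
  freshNeeded (I φ) (k , p) = suc k + freshNeeded φ p

  witnesses : ∀ N {n} (φ : DStar τ n) {c} {M′ : Struct τ c} {U : Team c n} → DSat M′ φ U → Slots (Rel N) φ
  witnesses N (rel i xs) _ = tt
  witnesses N (nrel i xs) _ = tt
  witnesses N (eq x y) _ = tt
  witnesses N (neq x y) _ = tt
  witnesses N (dep xs y) _ = tt
  witnesses N (inc xs zs) _ = tt
  witnesses N (exc xs zs) _ = tt
  witnesses N (ind xs zs ws) _ = tt
  witnesses N (and φ ψ) (p , q) = witnesses N φ p , witnesses N ψ q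
  witnesses N (or φ ψ) {c} (U₀ , U₁ , _ , _ , _ , p , q) =
    codeTeam c U₀ , codeTeam c U₁ , witnesses N φ p , witnesses N ψ q
    where open PrefixCoding N
  witnesses N (all φ) {c} {U = U} p = codeTeam c (λ t → U (tail t)) , witnesses N φ p
    where open PrefixCoding N
  witnesses N (ex φ) {c} {U = U} (f , _ , p) =
    codeTeam c (λ t → U (tail t) ∧ f (tail t) (head t)) , witnesses N φ p
    where open PrefixCoding N
  witnesses N (I φ) {c} {U = U} (k , p) =
    codeTeam (c + suc k) (liftTeamS {c} {suc k} U) , codeDomain (c + suc k) , witnesses N φ p
    where open PrefixCoding N

-- Completeness

module Completeness (τ σ : Vocab) (τ-ref : (i : Sym τ) → Ref σ (arity τ i)) (Y : Ref σ 1)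
  {N : ℕ} (E : Struct σ N) where
  open AuxiliaryRelations τ
  open Translation τ σ τ-ref Y
  open Windows τ σ τ-ref E
  open FOSatProperties E

  module AtomicCases {c} {M′ : Struct τ c} {D : Ref σ 1} (W : Window M′ D)
    {n} {R : Ref σ n} {U : Team c n} (exact : Exact W R U) where
    open Window W
    open WindowProperties W
    open Exact exact

    ∀∈-team : {φ : FO σ (n + 0)} → (∀ s → T (U s) → FOSat E φ (Vec.map emb s ++ [])) → FOSat E (∀∈ R φ) []
    ∀∈-team {φ} f = ∀∈⇐ R (λ v t → go v t (R⊆emb v t))
      where
      go : ∀ v → T (relOf E R v) → Σ _ (λ s → Vec.map emb s ≡ v) → FOSat E φ (v ++ [])
      go _ t (s , refl) = f s (decode s t)

    ∀²-team : {φ ψ : FO σ (n + (n + 0))} → (∀ env → Dec (FOSat E φ env)) →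
      (∀ v w → FOSat E φ (v ++ (w ++ [])) → T (relOf E R v) × T (relOf E R w)) →
      (∀ s t → T (U s) → T (U t) → let env = Vec.map emb s ++ (Vec.map emb t ++ []) in FOSat E φ env → FOSat E ψ env) →
      FOSat E (∀ⁿ n (∀ⁿ n (φ ⇒ᶠ ψ))) []
    ∀²-team {φ} {ψ} φ? φ⇒R² f = ∀²⇐ (λ v w → implication (φ? _) (λ h → go v w
        (R⊆emb v (proj₁ (φ⇒R² v w h)) , proj₁ (φ⇒R² v w h))
        (R⊆emb w (proj₂ (φ⇒R² v w h)) , proj₂ (φ⇒R² v w h)) h))
      where
      go : ∀ v w → Σ _ (λ s → Vec.map emb s ≡ v) × T (relOf E R v) → Σ _ (λ t → Vec.map emb t ≡ w) × T (relOf E R w) →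
        FOSat E φ (v ++ (w ++ [])) → FOSat E ψ (v ++ (w ++ []))
      go _ _ ((s , refl) , s∈R) ((t , refl) , t∈R) = f s t (decode s s∈R) (decode t t∈R)

    within : FOSat E (teamWithin R D) []
    within = teamWithin⇐ R D (λ v t j → go v (R⊆emb v t) j)
      where
      go : ∀ v → Σ _ (λ s → Vec.map emb s ≡ v) → ∀ j → T (relOf E D (lookup v j ∷ []))
      go _ (s , refl) j = subst (λ y → T (relOf E D (y ∷ []))) (sym (Vecₚ.lookup-map j emb s)) (emb∈D (lookup s j))

    R²? : ∀ env → Dec (FOSat E (atom R (block₁ (allFin n))) env × FOSat E (atom R (block₂ (allFin n))) env)
    R²? env = atom? R _ {env} ×-dec atom? R _ {env}

    R²⇒ : ∀ v w →
      FOSat E (atom R (block₁ (allFin n))) (v ++ (w ++ [])) × FOSat E (atom R (block₂ (allFin n))) (v ++ (w ++ [])) →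
      T (relOf E R v) × T (relOf E R w)
    R²⇒ v w (h₁ , h₂) = atom-block₁⇒ R v w h₁ , atom-block₂⇒ R v w h₂

    ≐-pair⇒ : ∀ {j} s t (xs zs : Vec (Fin n) j) →
      FOSat E (block₁ xs ≐ block₂ zs) (Vec.map emb s ++ (Vec.map emb t ++ [])) → vals s xs ≡ vals t zs
    ≐-pair⇒ s t xs zs h = vals-emb⁻¹ s t xs zs (≐⇒-via (block₁ xs) (block₂ zs) (Vec.map emb s ++ (Vec.map emb t ++ []))
      (vals-block₁ (Vec.map emb s) (Vec.map emb t) xs) (vals-block₂ (Vec.map emb s) (Vec.map emb t) zs) h)

    complete-rel : ∀ i xs → DSat M′ (rel i xs) U → FOSat E (translateStep (rel i xs) tt R D) []
    complete-rel i xs p = ∀∈-team (λ s s∈U →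
      atom⇐ (τ-ref i) _ (Vec.map emb s ++ []) (vals-emb-↑ˡ s xs) (subst T (interp-emb i _) (p s s∈U)))

    complete-nrel : ∀ i xs → DSat M′ (nrel i xs) U → FOSat E (translateStep (nrel i xs) tt R D) []
    complete-nrel i xs p = ∀∈-team (λ s s∈U h → p s s∈U (subst T (sym (interp-emb i _))
      (atom⇒ (τ-ref i) _ (Vec.map emb s ++ []) (vals-emb-↑ˡ s xs) h)))

    complete-eq : ∀ x y → DSat M′ (eq x y) U → FOSat E (translateStep (eq x y) tt R D) []
    complete-eq x y p = ∀∈-team (λ s s∈U →
      trans (lookup-emb s x) (trans (cong emb (p s s∈U)) (sym (lookup-emb s y))))

    complete-neq : ∀ x y → DSat M′ (neq x y) U → FOSat E (translateStep (neq x y) tt R D) []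
    complete-neq x y p = ∀∈-team (λ s s∈U q →
      p s s∈U (emb-injective _ _ (trans (sym (lookup-emb s x)) (trans q (lookup-emb s y)))))

    complete-dep : ∀ {j} (xs : Vec (Fin n) j) y → DSat M′ (dep xs y) U → FOSat E (translateStep (dep xs y) tt R D) []
    complete-dep xs y p = ∀²-team (λ env → atom? R _ {env} ×-dec (atom? R _ {env} ×-dec ≐? (block₁ xs) (block₂ xs) {env}))
      (λ v w (h₁ , h₂ , _) → R²⇒ v w (h₁ , h₂))
      (λ s t s∈U t∈U (_ , _ , xs≐) → trans (lookup-emb²ˡ s t y)
        (trans (cong emb (p s t s∈U t∈U (≐-pair⇒ s t xs xs xs≐))) (sym (lookup-emb²ʳ s t y))))

    complete-inc : ∀ {j} (xs zs : Vec (Fin n) j) → DSat M′ (inc xs zs) U → FOSat E (translateStep (inc xs zs) tt R D) []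
    complete-inc xs zs p = ∀∈-team (λ s s∈U → witness s (p s s∈U))
      where
      witness : ∀ s → Σ _ (λ t → T (U t) × vals s xs ≡ vals t zs) →
        FOSat E (∃ⁿ n (and (atom R (block₁ (allFin n))) (block₂ xs ≐ block₁ zs))) (Vec.map emb s ++ [])
      witness s (t , t∈U , xs≡zs) = ∃ⁿ⇐ n _ u
        ( atom-block₁⇐ R u v (encode t t∈U)
        , ≐⇐-via (block₂ xs) (block₁ zs) (u ++ (v ++ [])) (vals-block₂ u v xs) (vals-block₁ u v zs) (vals-emb s t xs zs xs≡zs))
        where
        u = Vec.map emb t
        v = Vec.map emb s

    complete-exc : ∀ {j} (xs zs : Vec (Fin n) j) → DSat M′ (exc xs zs) U → FOSat E (translateStep (exc xs zs) tt R D) []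
    complete-exc xs zs p = ∀²-team R²? R²⇒ (λ s t s∈U t∈U _ xs≐zs → p s t s∈U t∈U (≐-pair⇒ s t xs zs xs≐zs))

    complete-ind : ∀ {a b d} (xs : Vec (Fin n) a) (zs : Vec (Fin n) b) (ws : Vec (Fin n) d) →
      DSat M′ (ind xs zs ws) U → FOSat E (translateStep (ind xs zs ws) tt R D) []
    complete-ind xs zs ws p = ∀²-team (λ env → atom? R _ {env} ×-dec (atom? R _ {env} ×-dec ≐? (block₁ zs) (block₂ zs) {env}))
      (λ v w (h₁ , h₂ , _) → R²⇒ v w (h₁ , h₂))
      (λ s s′ s∈U s′∈U (_ , _ , zs≐) → witness s s′ (p s s′ s∈U s′∈U (≐-pair⇒ s s′ zs zs zs≐)))
      where
      witness : ∀ s s′ → Σ _ (λ t → T (U t) × vals t xs ≡ vals s xs × vals t zs ≡ vals s zs × vals t ws ≡ vals s′ ws) →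
        FOSat E (∃ⁿ n (and (atom R (block₁³ (allFin n)))
          (and (block₁³ xs ≐ block₂³ xs) (and (block₁³ zs ≐ block₂³ zs) (block₁³ ws ≐ block₃³ ws)))))
          (Vec.map emb s ++ (Vec.map emb s′ ++ []))
      witness s s′ (t , t∈U , xs≡ , zs≡ , ws≡) = ∃ⁿ⇐ n _ u
        ( atom-block₁³⇐ R u v w (encode t t∈U)
        , ≐⇐-via (block₁³ xs) (block₂³ xs) env (vals-block₁³ u v w xs) (vals-block₂³ u v w xs) (vals-emb t s xs xs xs≡)
        , ≐⇐-via (block₁³ zs) (block₂³ zs) env (vals-block₁³ u v w zs) (vals-block₂³ u v w zs) (vals-emb t s zs zs zs≡)
        , ≐⇐-via (block₁³ ws) (block₃³ ws) env (vals-block₁³ u v w ws) (vals-block₃³ u v w ws) (vals-emb t s′ ws ws ws≡))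
        where
        u = Vec.map emb t
        v = Vec.map emb s
        w = Vec.map emb s′
        env = u ++ (v ++ (w ++ []))

  open PrefixCoding N
  open Witnesses τ

  record Prefix {c} (M′ : Struct τ c) (D : Ref σ 1) : Set where
    field
      c≤N : c ≤ N
      D-codes : Interprets E D (codeDomain c)
      interp-prefix : ∀ i v → interp M′ i v ≡ relOf E (τ-ref i) (Vec.map (prefix c≤N) v)
      beyond⊆Y : ∀ y → c ≤ toℕ y → T (relOf E Y (y ∷ []))

    D⇐ : ∀ y → toℕ y < c → T (relOf E D (y ∷ []))
    D⇐ y y<c = subst T (sym (D-codes (y ∷ []))) (ℕₚ.<⇒<ᵇ y<c)

    D⇒ : ∀ y → T (relOf E D (y ∷ [])) → toℕ y < c
    D⇒ y d = ℕₚ.<ᵇ⇒< _ _ (subst T (D-codes (y ∷ [])) d)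

  prefixWindow : ∀ {c} {M′ : Struct τ c} {D} → Prefix M′ D → Window M′ D
  prefixWindow {c} P = record
    { emb = prefix c≤N
    ; emb-injective = prefix-injective c≤N
    ; interp-emb = interp-prefix
    ; emb∈D = λ x → D⇐ _ (subst (_< c) (sym (toℕ-prefix c≤N x)) (Finₚ.toℕ<n x))
    ; D⊆emb = λ y d → fromℕ< (D⇒ y d) , prefix-fromℕ< c≤N y (D⇒ y d) }
    where open Prefix P

  prefixExact : ∀ {c} {M′ : Struct τ c} {D} (P : Prefix M′ D) {n} {R : Ref σ n} {U : Team c n} →
    Interprets E R (codeTeam c U) → Exact (prefixWindow P) R U
  prefixExact {c} P {U = U} R-codes = record
    { codes = record { encode = encode ; decode = decode }
    ; R⊆emb = λ v t → let (s , p , _) = codeTeam⇒ c≤N U v (subst T (R-codes v) t) in s , p }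
    where
    open Prefix P
    encode : ∀ s → T (U s) → _
    encode s t = subst T (sym (R-codes _)) (codeTeam⇐ c≤N U s t)
    decode : ∀ s → _ → T (U s)
    decode s t with codeTeam⇒ c≤N U _ (subst T (R-codes _) t)
    ... | s′ , p , s′∈U = subst (λ s → T (U s)) (map-injective (prefix c≤N) (prefix-injective c≤N) s′ s p) s′∈U


  module ConnectiveCases {c} {M′ : Struct τ c} {D : Ref σ 1} (P : Prefix M′ D)
    {n} {R : Ref σ n} {U : Team c n} (R-codes : Interprets E R (codeTeam c U)) where
    open AtomicCases using (∀∈-team)
    open Window (prefixWindow P)
    exactR = prefixExact P {R = R} {U = U} R-codes
    open Exact exactR

    complete-or : ∀ (φ ψ : DStar τ n) L₁ L₂ {U₀ U₁ : Team c n} {R₀ R₁ : Ref σ n} →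
      (∀ s → T (U s) → T (U₀ s) ⊎ T (U₁ s)) → (∀ s → T (U₀ s) → T (U s)) → (∀ s → T (U₁ s) → T (U s)) →
      Interprets E R₀ (codeTeam c U₀) → Interprets E R₁ (codeTeam c U₁) →
      FOSat E (translate φ L₁ R₀ D) [] → FOSat E (translate ψ L₂ R₁ D) [] →
      FOSat E (translateStep (or φ ψ) (R₀ , R₁ , L₁ , L₂) R D) []
    complete-or φ ψ L₁ L₂ {U₀} {U₁} {R₀} {R₁} cover U₀⊆U U₁⊆U R₀-codes R₁-codes h₀ h₁ =
        ∀∈-team (prefixWindow P) exactR (λ s s∈U → R₀∪R₁ s (cover s s∈U))
      , ∀∈-team (prefixWindow P) exact₀ (λ s s∈U₀ → atom-vars⇐ R _ (encode s (U₀⊆U s s∈U₀)))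
      , ∀∈-team (prefixWindow P) exact₁ (λ s s∈U₁ → atom-vars⇐ R _ (encode s (U₁⊆U s s∈U₁)))
      , h₀ , h₁
      where
      exact₀ = prefixExact P {R = R₀} {U = U₀} R₀-codes
      exact₁ = prefixExact P {R = R₁} {U = U₁} R₁-codes
      R₀∪R₁ : ∀ s → T (U₀ s) ⊎ T (U₁ s) → FOSat E (or (atom R₀ (vars n)) (atom R₁ (vars n))) (Vec.map emb s ++ [])
      R₀∪R₁ s (inj₁ s∈U₀) = inj₁ (atom-vars⇐ R₀ _ (Exact.encode exact₀ s s∈U₀))
      R₀∪R₁ s (inj₂ s∈U₁) = inj₂ (atom-vars⇐ R₁ _ (Exact.encode exact₁ s s∈U₁))

    complete-all : ∀ (φ : DStar τ (suc n)) L {R′ : Ref σ (suc n)} →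
      Interprets E R′ (codeTeam c (λ t → U (tail t))) → FOSat E (translate φ L R′ D) [] →
      FOSat E (translateStep (all φ) (R′ , L) R D) []
    complete-all φ L {R′} R′-codes hφ = ∀∈-team (prefixWindow P) exact′ R′⇒ , ∀ⁿ⇐ (suc n) _ ⇒R′ , hφ
      where
      exact′ = prefixExact P {R = R′} {U = λ t → U (tail t)} R′-codes
      R′⇒ : ∀ t → T (U (tail t)) → FOSat E (and (atom R (outerVars n)) (atom D (boundVar n))) (Vec.map emb t ++ [])
      R′⇒ (x ∷ s) s∈U = atom-outer⇐ R _ _ (encode s s∈U) , atom-bound⇐ D _ _ (emb∈D x)
      ⇒R′ : ∀ t → FOSat E (and (atom R (outerVars n)) (atom D (boundVar n)) ⇒ᶠ atom R′ (vars (suc n))) (t ++ [])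
      ⇒R′ (y ∷ v) = implication (atom? R _ {env} ×-dec atom? D _ {env}) λ (h₁ , h₂) →
        let (s , s≡v) = R⊆emb v (atom-outer⇒ R y v h₁)
            (x , x≡y) = D⊆emb y (atom-bound⇒ D y v h₂)
        in atom-vars⇐ R′ (y ∷ v) (subst₂ (λ y v → T (relOf E R′ (y ∷ v))) x≡y s≡v
             (Exact.encode exact′ (x ∷ s) (decode s (subst (λ v → T (relOf E R v)) (sym s≡v) (atom-outer⇒ R y v h₁)))))
        where env = (y ∷ v) ++ []

    complete-ex : ∀ (φ : DStar τ (suc n)) L {R′ : Ref σ (suc n)} (f : Vec (Fin c) n → Fin c → Bool) →
      (∀ s → T (U s) → Σ (Fin c) λ x → T (f s x)) →
      Interprets E R′ (codeTeam c (λ t → U (tail t) ∧ f (tail t) (head t))) → FOSat E (translate φ L R′ D) [] →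
      FOSat E (translateStep (ex φ) (R′ , L) R D) []
    complete-ex φ L {R′} f nonempty R′-codes hφ =
        ∀∈-team (prefixWindow P) exact′ (λ { (x ∷ s) t → atom-outer⇐ R _ _ (encode s (T-∧-fst t)) })
      , ∀∈-team (prefixWindow P) exactR R⇒∃
      , hφ
      where
      exact′ = prefixExact P {R = R′} {U = λ t → U (tail t) ∧ f (tail t) (head t)} R′-codes
      R⇒∃ : ∀ s → T (U s) → FOSat E (ex (atom R′ (zero ∷ Vec.map suc (vars n)))) (Vec.map emb s ++ [])
      R⇒∃ s s∈U with nonempty s s∈U
      ... | x , fx = emb x , atom⇐ R′ _ (emb x ∷ (Vec.map emb s ++ []))
        (cong (emb x ∷_) (trans (vals-suc (emb x) _ (vars n)) (vals-vars _)))
        (Exact.encode exact′ (x ∷ s) (T-∧-intro s∈U fx))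

  module _ (τ-avoids-Y : ∀ i (v : Vec (Fin N) (arity τ i)) l →
             T (relOf E Y (lookup v l ∷ [])) → relOf E (τ-ref i) v ≡ false) where

    -- The fresh elements of I are the next suc k points after the prefix Fin c.
    complete-I : ∀ {n} (φ : DStar τ (suc n)) {c} {M′ : Struct τ c} {U : Team c n} (k : ℕ)
      (L : Slots (Ref σ) φ) {R : Ref σ n} {D : Ref σ 1} (P : Prefix M′ D) {R′ : Ref σ (suc n)} {D′ : Ref σ 1} →
      c + suc k ≤ N → Interprets E R (codeTeam c U) →
      Interprets E R′ (codeTeam (c + suc k) (liftTeamS {c} {suc k} U)) → Interprets E D′ (codeDomain (c + suc k)) →
      (Prefix (M′ +S suc k) D′ → FOSat E (translate φ L R′ D′) []) →
      FOSat E (translateStep (I φ) (R′ , D′ , L) R D) []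
    complete-I {n} φ {c} {M′} {U} k L {R} {D} P {R′} {D′} c′≤N R-codes R′-codes D′-codes IH =
      D⊆D′ , D′⊆D∪Y , fresh , ∀∈-team′ R′⇒ , ∀ⁿ⇐ (suc n) _ ⇒R′ , IH P′
      where
      open Prefix P
      open Window (prefixWindow P)
      open Exact (prefixExact P {R = R} {U = U} R-codes)
      c′ = c + suc k
      In : Ref σ 1 → Fin N → Set
      In X y = T (relOf E X (y ∷ []))
      e′ : Fin c′ → Fin N
      e′ = prefix c′≤N
      toℕ-e′-↑ʳ : ∀ j → toℕ (e′ (c ↑ʳ j)) ≡ c + toℕ j
      toℕ-e′-↑ʳ j = trans (toℕ-prefix c′≤N _) (Finₚ.toℕ-↑ʳ c j)
      e′-↑ˡ : ∀ x → e′ (x ↑ˡ suc k) ≡ emb x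
      e′-↑ˡ x = Finₚ.toℕ-injective (trans (toℕ-prefix c′≤N _)
        (trans (Finₚ.toℕ-↑ˡ x (suc k)) (sym (toℕ-prefix c≤N x))))
      map-e′-↑ˡ : ∀ {m} (s : Vec (Fin c) m) → Vec.map e′ (Vec.map (_↑ˡ suc k) s) ≡ Vec.map emb s
      map-e′-↑ˡ s = trans (sym (Vecₚ.map-∘ e′ (_↑ˡ suc k) s)) (Vecₚ.map-cong e′-↑ˡ s)
      P′ : Prefix (M′ +S suc k) D′
      P′ = record
        { c≤N = c′≤N
        ; D-codes = D′-codes
        ; interp-prefix = interp-+S-via emb e′ interp-prefix e′-↑ˡ (λ i v l j p → τ-avoids-Y i v l
            (subst (In Y) (sym p) (beyond⊆Y _ (subst (c ≤_) (sym (toℕ-e′-↑ʳ j)) (ℕₚ.m≤m+n c _)))))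
        ; beyond⊆Y = λ y c′≤y → beyond⊆Y y (ℕₚ.≤-trans (ℕₚ.m≤m+n c (suc k)) c′≤y) }
      open Prefix P′ using () renaming (D⇐ to D′⇐; D⇒ to D′⇒)
      open AtomicCases (prefixWindow P′) (prefixExact P′ {R = R′} R′-codes) using () renaming (∀∈-team to ∀∈-team′)

      D⊆D′ : FOSat E (all (atom D x₀ ⇒ᶠ atom D′ x₀)) []
      D⊆D′ y = implication (atom? D x₀ {y ∷ []}) (λ h → atom⇐ D′ x₀ (y ∷ []) refl
        (D′⇐ y (ℕₚ.<-≤-trans (D⇒ y (atom⇒ D x₀ (y ∷ []) refl h)) (ℕₚ.m≤m+n c (suc k)))))

      D′⊆D∪Y : FOSat E (all (atom D′ x₀ ⇒ᶠ or (atom D x₀) (atom Y x₀))) []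
      D′⊆D∪Y y = implication (atom? D′ x₀ {y ∷ []}) (λ _ → D∪Y)
        where
        D∪Y : FOSat E (or (atom D x₀) (atom Y x₀)) (y ∷ [])
        D∪Y with toℕ y ℕₚ.<? c
        ... | yes y<c = inj₁ (atom⇐ D x₀ (y ∷ []) refl (D⇐ y y<c))
        ... | no y≮c = inj₂ (atom⇐ Y x₀ (y ∷ []) refl (beyond⊆Y y (ℕₚ.≮⇒≥ y≮c)))

      fresh : FOSat E (ex (and (atom D′ x₀) (neg (atom D x₀)))) []
      fresh = y₀ , atom⇐ D′ x₀ (y₀ ∷ []) refl (D′⇐ y₀ (subst (_< c′) (sym toℕ-y₀) (ℕₚ.m<m+n c ℕ.z<s)))
                 , λ h → ℕₚ.<-irrefl refl (subst (_< c) toℕ-y₀ (D⇒ y₀ (atom⇒ D x₀ (y₀ ∷ []) refl h)))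
        where
        c<N : c < N
        c<N = ℕₚ.<-≤-trans (ℕₚ.m<m+n c ℕ.z<s) c′≤N
        y₀ = fromℕ< c<N
        toℕ-y₀ = Finₚ.toℕ-fromℕ< c<N

      freshExtension : FO σ (suc n + 0)
      freshExtension = and (atom R (outerVars n)) (and (atom D′ (boundVar n)) (neg (atom D (boundVar n))))

      R′⇒ : ∀ t → T (liftTeamS {c} {suc k} U t) → FOSat E freshExtension (Vec.map e′ t ++ [])
      R′⇒ (z ∷ s) z∷s∈U′ with liftTeamS⇒ U z s z∷s∈U′
      ... | s₀ , refl , z-new , s₀∈U with isNew⇒new z z-new
      ... | j , refl =
          atom-outer⇐ R _ _ (subst (λ v → T (relOf E R v)) (sym (map-e′-↑ˡ s₀)) (encode s₀ s₀∈U))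
        , atom-bound⇐ D′ _ _ (D′⇐ _ (subst (_< c′) (sym (toℕ-prefix c′≤N _)) (Finₚ.toℕ<n _)))
        , λ h → ℕₚ.<⇒≱ (D⇒ _ (atom-bound⇒ D _ _ h)) (subst (c ≤_) (sym (toℕ-e′-↑ʳ j)) (ℕₚ.m≤m+n c _))

      ⇒R′ : ∀ t → FOSat E (freshExtension ⇒ᶠ atom R′ (vars (suc n))) (t ++ [])
      ⇒R′ (y ∷ v) = implication (atom? R _ {env} ×-dec (atom? D′ _ {env} ×-dec ¬? (atom? D _ {env}))) λ (h₁ , h₂ , h₃) →
        let (s , s≡v) = R⊆emb v (atom-outer⇒ R y v h₁)
            y<c′ = D′⇒ y (atom-bound⇒ D′ y v h₂)
        in atom-vars⇐ R′ (y ∷ v) (subst₂ (λ y v → T (relOf E R′ (y ∷ v)))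
             (prefix-fromℕ< c′≤N y y<c′) (trans (map-e′-↑ˡ s) s≡v)
             (subst T (sym (R′-codes _)) (codeTeam⇐ c′≤N (liftTeamS {c} {suc k} U) (fromℕ< y<c′ ∷ Vec.map (_↑ˡ suc k) s)
               (liftTeamS⇐ U _ s (≤toℕ⇒isNew _ (new-index y<c′ (λ y<c → h₃ (atom-bound⇐ D y v (D⇐ y y<c)))))
                 (decode s (subst (λ v → T (relOf E R v)) (sym s≡v) (atom-outer⇒ R y v h₁)))))))
        where
        env = (y ∷ v) ++ []
        new-index : (y<c′ : toℕ y < c′) → ¬ (toℕ y < c) → c ≤ toℕ (fromℕ< y<c′)
        new-index y<c′ y≮c = subst (c ≤_) (sym (Finₚ.toℕ-fromℕ< y<c′)) (ℕₚ.≮⇒≥ y≮c)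

    room-⊔ˡ : ∀ c {a b} → c + (a ⊔ b) ≤ N → c + a ≤ N
    room-⊔ˡ c room = ℕₚ.≤-trans (ℕₚ.+-monoʳ-≤ c (ℕₚ.m≤m⊔n _ _)) room

    room-⊔ʳ : ∀ c {a b} → c + (a ⊔ b) ≤ N → c + b ≤ N
    room-⊔ʳ c room = ℕₚ.≤-trans (ℕₚ.+-monoʳ-≤ c (ℕₚ.m≤n⊔m _ _)) room

    mutual
      complete : ∀ {n} (φ : DStar τ n) {c} {M′ : Struct τ c} {U : Team c n} (p : DSat M′ φ U)
        (L : Slots (Ref σ) φ) {R : Ref σ n} {D : Ref σ 1} (P : Prefix M′ D) →
        c + freshNeeded φ p ≤ N → Realises E φ L (witnesses N φ p) → Interprets E R (codeTeam c U) →
        FOSat E (translate φ L R D) []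
      complete φ p L {R} P room real R-codes =
        AtomicCases.within (prefixWindow P) (prefixExact P {R = R} R-codes) , completeStep φ p L P room real R-codes

      completeStep : ∀ {n} (φ : DStar τ n) {c} {M′ : Struct τ c} {U : Team c n} (p : DSat M′ φ U)
        (L : Slots (Ref σ) φ) {R : Ref σ n} {D : Ref σ 1} (P : Prefix M′ D) →
        c + freshNeeded φ p ≤ N → Realises E φ L (witnesses N φ p) → Interprets E R (codeTeam c U) →
        FOSat E (translateStep φ L R D) []
      completeStep (rel i xs) p _ {R} P _ _ R-codes =
        AtomicCases.complete-rel (prefixWindow P) (prefixExact P {R = R} R-codes) i xs p
      completeStep (nrel i xs) p _ {R} P _ _ R-codes =
        AtomicCases.complete-nrel (prefixWindow P) (prefixExact P {R = R} R-codes) i xs p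
      completeStep (eq x y) p _ {R} P _ _ R-codes =
        AtomicCases.complete-eq (prefixWindow P) (prefixExact P {R = R} R-codes) x y p
      completeStep (neq x y) p _ {R} P _ _ R-codes =
        AtomicCases.complete-neq (prefixWindow P) (prefixExact P {R = R} R-codes) x y p
      completeStep (dep xs y) p _ {R} P _ _ R-codes =
        AtomicCases.complete-dep (prefixWindow P) (prefixExact P {R = R} R-codes) xs y p
      completeStep (inc xs zs) p _ {R} P _ _ R-codes =
        AtomicCases.complete-inc (prefixWindow P) (prefixExact P {R = R} R-codes) xs zs p
      completeStep (exc xs zs) p _ {R} P _ _ R-codes =
        AtomicCases.complete-exc (prefixWindow P) (prefixExact P {R = R} R-codes) xs zs p
      completeStep (ind xs zs ws) p _ {R} P _ _ R-codes =
        AtomicCases.complete-ind (prefixWindow P) (prefixExact P {R = R} R-codes) xs zs ws p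
      completeStep (and φ ψ) {c} (p , q) (L₁ , L₂) P room (real₁ , real₂) R-codes =
        complete φ p L₁ P (room-⊔ˡ c room) real₁ R-codes , complete ψ q L₂ P (room-⊔ʳ c room) real₂ R-codes
      completeStep (or φ ψ) {c} (U₀ , U₁ , cover , U₀⊆U , U₁⊆U , p₀ , p₁) (R₀ , R₁ , L₁ , L₂) P room
        (R₀-codes , R₁-codes , real₀ , real₁) R-codes =
        ConnectiveCases.complete-or P R-codes φ ψ L₁ L₂ cover U₀⊆U U₁⊆U R₀-codes R₁-codes
          (complete φ p₀ L₁ P (room-⊔ˡ c room) real₀ R₀-codes) (complete ψ p₁ L₂ P (room-⊔ʳ c room) real₁ R₁-codes)
      completeStep (all φ) p (R′ , L) P room (R′-codes , real) R-codes =
        ConnectiveCases.complete-all P R-codes φ L R′-codes (complete φ p L P room real R′-codes)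
      completeStep (ex φ) (f , nonempty , p) (R′ , L) P room (R′-codes , real) R-codes =
        ConnectiveCases.complete-ex P R-codes φ L f nonempty R′-codes (complete φ p L P room real R′-codes)
      completeStep (I φ) {c} {U = U} (k , p) (R′ , D′ , L) {R} P room (R′-codes , D′-codes , real) R-codes =
        complete-I φ k L P c′≤N R-codes R′-codes (λ v → D′-codes v)
          (λ P′ → complete φ p L P′ (subst (_≤ N) (sym (ℕₚ.+-assoc c (suc k) _)) room) real R′-codes)
        where
        c′≤N : c + suc k ≤ N
        c′≤N = ℕₚ.≤-trans (ℕₚ.m≤m+n (c + suc k) _) (subst (_≤ N) (sym (ℕₚ.+-assoc c (suc k) _)) room)

-- The L_RE sentence: guess a 0-ary root team {∅} and the old domain A (the complement
-- of Y), together with all auxiliary relations, and assert the translation.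

module Reduction (τ : Vocab) (φ : DStar τ 0) where
  open AuxiliaryRelations τ

  aux : Vocab
  aux = 0 List.∷ 1 List.∷ auxVocab φ

  σ : Vocab
  σ = aux List.++ (1 List.∷ τ)

  τ-ref : (i : Sym τ) → Ref σ (arity τ i)
  τ-ref i = weakenˡ aux (there (refOf i))

  Y : Ref σ 1
  Y = weakenˡ aux here

  rootTeam : Ref σ 0
  rootTeam = here

  oldDomain : Ref σ 1
  oldDomain = there here

  open Translation τ σ τ-ref Y

  rootRefs : Slots (Ref σ) φ
  rootRefs = mapSlots (λ r → there (there (weakenʳ (1 List.∷ τ) r))) φ (auxRefs φ)

  sentence : FO σ 0
  sentence = and (atom rootTeam [])
    (and (all (atom oldDomain x₀ ⇒ᶠ neg (atom Y x₀)))
    (and (all (neg (atom Y x₀) ⇒ᶠ atom oldDomain x₀))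
    (translate φ rootRefs rootTeam oldDomain)))

  translation : LRE τ
  translation = ∃SO aux sentence

  module Expansion {m K : ℕ} (𝔄 : Struct τ (suc m)) (Xs : Struct aux (suc m + suc K)) where
    base : Struct (1 List.∷ τ) (suc m + suc K)
    base = YRel {suc m} {suc K} , (𝔄 +S suc K)

    E : Struct σ (suc m + suc K)
    E = expand Xs base

    relOf-Y : ∀ y → relOf E Y (y ∷ []) ≡ isNew {suc m} {suc K} y
    relOf-Y y = relOf-weakenˡ Xs base here (y ∷ [])

    relOf-τ : ∀ i v → relOf E (τ-ref i) v ≡ extRel {suc m} {suc K} (interp 𝔄 i) v
    relOf-τ i v = trans (relOf-weakenˡ Xs base (there (refOf i)) v)
      (trans (relOf-refOf (𝔄 +S suc K) i v) (cong (λ R → R v) (interp-+S 𝔄 (suc K) i)))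

    τ-avoids-Y : ∀ i (v : Vec (Fin (suc m + suc K)) (arity τ i)) l →
      T (relOf E Y (lookup v l ∷ [])) → relOf E (τ-ref i) v ≡ false
    τ-avoids-Y i v l t = trans (relOf-τ i v) (extRel-isNew (interp 𝔄 i) v l (subst T (relOf-Y _) t))

    interp-↑ˡ : ∀ i v → interp 𝔄 i v ≡ relOf E (τ-ref i) (Vec.map (_↑ˡ suc K) v)
    interp-↑ˡ i v = sym (trans (relOf-τ i _) (extRel-↑ˡ (interp 𝔄 i) v))

  translation-sound : ∀ {m} (𝔄 : Struct τ (suc m)) → LRETrue 𝔄 translation → DTrue 𝔄 φ
  translation-sound 𝔄 (K , Xs , root , old⊆¬Y , ¬Y⊆old , h) =
    sound τ-avoids-Y φ rootRefs rootTeam oldDomain window (λ _ → true)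
      (record { encode = λ { [] _ → atom⇒ rootTeam [] [] refl root } ; decode = λ _ _ → tt }) h
    where
    open Expansion {K = K} 𝔄 Xs
    open Soundness τ σ τ-ref Y E
    open Windows τ σ τ-ref E
    open FOSatProperties E
    window : Window 𝔄 oldDomain
    window = record
      { emb = _↑ˡ suc K
      ; emb-injective = Finₚ.↑ˡ-injective (suc K)
      ; interp-emb = interp-↑ˡ
      ; emb∈D = λ x → atom⇒ oldDomain x₀ ((x ↑ˡ suc K) ∷ []) refl (modus-ponens (¬Y⊆old (x ↑ˡ suc K))
          (λ h → ¬T-false (isNew-↑ˡ x) (subst T (relOf-Y _) (atom⇒ Y x₀ ((x ↑ˡ suc K) ∷ []) refl h))))
      ; D⊆emb = λ y d → let (x , y≡x) = ¬isNew⇒old y (λ t → modus-ponens (old⊆¬Y y) (atom⇐ oldDomain x₀ (y ∷ []) refl d)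
                                           (atom⇐ Y x₀ (y ∷ []) refl (subst T (sym (relOf-Y y)) t)))
                        in x , sym y≡x }

  translation-complete : ∀ {m} (𝔄 : Struct τ (suc m)) → DTrue 𝔄 φ → LRETrue 𝔄 translation
  translation-complete {m} 𝔄 p = K , Xs , tt , old⊆¬Y , ¬Y⊆old ,
    complete τ-avoids-Y φ p rootRefs prefix-𝔄 (ℕₚ.+-monoʳ-≤ (suc m) (ℕₚ.n≤1+n K)) realises (λ { [] → refl })
    where
    open Witnesses τ
    K = freshNeeded φ p
    N = suc m + suc K
    open PrefixCoding N
    V = witnesses N φ p
    Xs : Struct aux N
    Xs = (λ _ → true) , codeDomain (suc m) , auxStruct φ V
    open Expansion 𝔄 Xs
    open Completeness τ σ τ-ref Y E
    open FOSatProperties E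
    old⊆¬Y : FOSat E (all (atom oldDomain x₀ ⇒ᶠ neg (atom Y x₀))) []
    old⊆¬Y y = implication (atom? oldDomain x₀ {y ∷ []}) (λ h h′ →
      ℕₚ.<⇒≱ (ℕₚ.<ᵇ⇒< _ _ (atom⇒ oldDomain x₀ (y ∷ []) refl h))
             (isNew⇒≤toℕ y (subst T (relOf-Y y) (atom⇒ Y x₀ (y ∷ []) refl h′))))
    ¬Y⊆old : FOSat E (all (neg (atom Y x₀) ⇒ᶠ atom oldDomain x₀)) []
    ¬Y⊆old y = implication (¬? (atom? Y x₀ {y ∷ []})) (λ h → atom⇐ oldDomain x₀ (y ∷ []) refl
      (ℕₚ.<⇒<ᵇ (ℕₚ.≰⇒> (λ m<y → h (atom⇐ Y x₀ (y ∷ []) refl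
        (subst T (sym (relOf-Y y)) (≤toℕ⇒isNew y m<y)))))))
    prefix-𝔄 : Prefix 𝔄 oldDomain
    prefix-𝔄 = record
      { c≤N = ℕₚ.m≤m+n (suc m) (suc K)
      ; D-codes = λ { (y ∷ []) → refl }
      ; interp-prefix = λ i v → trans (interp-↑ˡ i v) (cong (relOf E (τ-ref i)) (Vecₚ.map-cong
          (λ x → Finₚ.toℕ-injective (trans (Finₚ.toℕ-↑ˡ x (suc K)) (sym (toℕ-prefix _ x)))) v))
      ; beyond⊆Y = λ y m<y → subst T (sym (relOf-Y y)) (≤toℕ⇒isNew y m<y) }
    realises : Realises E φ rootRefs V
    realises = Realises-map _ (auxStruct φ V) E (relOf-weakenʳ (auxStruct φ V) base) φ (auxRefs φ) V
      (auxStruct-realises φ V)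

mainTheorem5 : (τ : Vocab) (φ : DStar τ 0) →
    Σ (LRE τ) λ ψ →
    (m : ℕ) (𝔄 : Struct τ (suc m)) → (DTrue 𝔄 φ ⇔ LRETrue 𝔄 ψ)
mainTheorem5 τ φ = translation , λ m 𝔄 → mk⇔ (translation-complete 𝔄) (translation-sound 𝔄)
  where open Reduction τ φ
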